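{- For every $n\geq 1$, the Euler number $E_n$ equals the number of total cyclic orders $Z$ on $[n+1]=\{1,\dots,n+1\}$ such that $(i,i+1,i+2)\in Z$ for every $1\leq i\leq n-1$.
   Context: A total cyclic order on a finite set $X$ is a set $Z$ of triples of distinct elements of $X$ such that: $(x,y,z)\in Z\Rightarrow (y,z,x)\in Z$; $(x,y,z)\in Z\Rightarrow (z,y,x)\notin Z$; $(x,y,z)\in Z$ and $(x,z,u)\in Z\Rightarrow (x,y,u)\in Z$; and for any three distinct $x,y,z$, either $(x,y,z)\in Z$ or $(z,y,x)\in Z$. The Euler number $E_n$ is $F^{(n)}(0)$ where $F(x)=\sec x+\tan x$; equivalently it is the number of up/down permutations $\sigma$ of $[n]$, i.e. those with $\sigma(1)<\sigma(2)>\sigma(3)<\cdots$ (ascents at odd positions, descents at even positions). -}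

module Defs where

open import Data.Nat using (ℕ; zero; suc; _+_)
open import Data.Nat.Properties using () renaming (_≟_ to _≟ℕ_)
open import Data.Bool using (T; T?; Bool; true; false; _∧_; _∨_; not; if_then_else_)
open import Data.Fin using (Fin; toℕ; _<?_) renaming (_≟_ to _≟F_)
open import Data.List using (List; []; _∷_; map; concatMap; filter; length; foldr)
open import Data.List.Base using (allFin)
open import Data.Vec using (Vec; []; _∷_; lookup)
open import Relation.Nullary.Decidable using (⌊_⌋)

_⇒ᵇ_ : Bool → Bool → Bool
a ⇒ᵇ b = not a ∨ b
infixr 4 _⇒ᵇ_

vecs : ∀ {A : Set} → List A → (k : ℕ) → List (Vec A k)
vecs xs zero    = [] ∷ []
vecs xs (suc k) = concatMap (λ x → map (x ∷_) (vecs xs k)) xs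

count : ∀ {A : Set} → (A → Bool) → List A → ℕ
count p xs = length (filter (λ x → T? (p x)) xs)

-- Ternary relations on Fin m, i.e. sets of triples, stored as a cube
-- of booleans: (x,y,z) ∈ Z  iff  the (x,y,z) entry is true.

Cube : ℕ → Set
Cube m = Vec (Vec (Vec Bool m) m) m

_∋⟨_,_,_⟩ : ∀ {m} → Cube m → Fin m → Fin m → Fin m → Bool
infix 8 _∋⟨_,_,_⟩
Z ∋⟨ x , y , z ⟩ = lookup (lookup (lookup Z x) y) z

allCubes : (m : ℕ) → List (Cube m)
allCubes m = vecs (vecs (vecs (true ∷ false ∷ []) m) m) m

∀ᶠ : ∀ {m} → (Fin m → Bool) → Bool
∀ᶠ {m} p = foldr (λ i b → p i ∧ b) true (allFin m)

neq : ∀ {m} → Fin m → Fin m → Bool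
neq x y = not ⌊ x ≟F y ⌋

distinct3 : ∀ {m} → Fin m → Fin m → Fin m → Bool
distinct3 x y z = neq x y ∧ neq y z ∧ neq x z

isTotalCyclicOrder : ∀ {m} → Cube m → Bool
isTotalCyclicOrder Z =
  ∀ᶠ λ x → ∀ᶠ λ y → ∀ᶠ λ z → ∀ᶠ λ u →
       (Z ∋⟨ x , y , z ⟩ ⇒ᵇ distinct3 x y z)
     ∧ (Z ∋⟨ x , y , z ⟩ ⇒ᵇ Z ∋⟨ y , z , x ⟩)
     ∧ (Z ∋⟨ x , y , z ⟩ ⇒ᵇ not (Z ∋⟨ z , y , x ⟩))
     ∧ ((Z ∋⟨ x , y , z ⟩ ∧ Z ∋⟨ x , z , u ⟩) ⇒ᵇ Z ∋⟨ x , y , u ⟩)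
     ∧ (distinct3 x y z ⇒ᵇ (Z ∋⟨ x , y , z ⟩ ∨ Z ∋⟨ z , y , x ⟩))

-- (i, i+1, i+2) ∈ Z whenever all three lie in the ground set
-- (elements of Fin m represent 1..m via toℕ + 1)
consecutiveIn : ∀ {m} → Cube m → Bool
consecutiveIn Z =
  ∀ᶠ λ x → ∀ᶠ λ y → ∀ᶠ λ z →
    (⌊ toℕ y ≟ℕ suc (toℕ x) ⌋ ∧ ⌊ toℕ z ≟ℕ suc (suc (toℕ x)) ⌋)
      ⇒ᵇ Z ∋⟨ x , y , z ⟩

-- Euler numbers as the number of up/down permutations of [n].
-- A permutation σ of [n] is stored as the vector (σ(1),…,σ(n)).

lookupᵇ : ∀ {n} → Vec (Fin n) n → Fin n → Fin n
lookupᵇ = lookup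

isPermutation : ∀ {n} → Vec (Fin n) n → Bool
isPermutation σ = ∀ᶠ λ i → ∀ᶠ λ j → neq i j ⇒ᵇ neq (lookup σ i) (lookup σ j)

even : ℕ → Bool
even zero          = true
even (suc zero)    = false
even (suc (suc k)) = even k

-- 0-indexed position p (= 1-indexed position p+1): ascent if p+1 is odd,
-- descent if p+1 is even.
isUpDown : ∀ {n} → Vec (Fin n) n → Bool
isUpDown σ = ∀ᶠ λ p → ∀ᶠ λ q →
  ⌊ toℕ q ≟ℕ suc (toℕ p) ⌋ ⇒ᵇ
    (if even (toℕ p)
       then ⌊ lookup σ p <? lookup σ q ⌋
       else ⌊ lookup σ q <? lookup σ p ⌋)

EulerNumber : ℕ → ℕ
EulerNumber n = count (λ σ → isPermutation σ ∧ isUpDown σ) (vecs (allFin n) n)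

-- A total cyclic order Z on [n + 1] is determined by the linear order obtained by cutting the cycle
-- just after n + 1. Recording the rank of every element in that order turns Z into a permutation τ of
-- [n + 1] ending with n + 1, and (i, i + 1, i + 2) ∈ Z becomes: every three consecutive entries of τ
-- are cyclically ordered. These "cyclic chains" and the up/down permutations of [n] are both counted
-- by deleting the first entry and standardising the rest. Refined by a statistic t of the first entry
-- (for up/down permutations the number of values the second entry may take, for chains the number of
-- values on the arc from the second entry up to the first), both counts f satisfy
--   f (k + 2) t = ∑ { f (k + 1) t′ ∣ t′ ≤ k , k + 1 ≤ t + t′ }
-- because for every shorter sequence exactly one new first entry produces the statistic t, and it is
-- admissible exactly when k + 1 ≤ t + t′. Both start from f 1 0 = 1, hence they agree.

module Submission where

open import Defs
open import Data.Bool using (Bool; true; false; T; T?; _∧_; _∨_; not; if_then_else_)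
open import Data.Bool.Properties using (T-≡; T-∧; T-∨; ∧-assoc; ∧-comm; ∧-identityʳ; ∧-zeroʳ; ∧-commutativeMonoid)
open import Data.Empty using (⊥-elim)
open import Data.Fin using (Fin; zero; suc; toℕ; fromℕ; fromℕ<; punchIn; punchOut; _≟_; _<?_)
open import Data.Fin.Properties
  using (toℕ-fromℕ<; toℕ-injective; toℕ<n; toℕ≤pred[n]; punchIn-injective; punchInᵢ≢i; punchIn-punchOut;
         punchIn-mono-≤; punchIn-cancel-≤)
  renaming (suc-injective to Fin-suc-injective)
open import Data.List using (List; []; _∷_; _++_; concatMap; filter; length; allFin)
import Data.List as List
open import Data.List.Properties using (filter-++; length-++; length-map)
open import Data.List.Membership.Propositional using (_∈_)
open import Data.List.Membership.Propositional.Properties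
  using (∈-map⁺; ∈-map⁻; ∈-filter⁺; ∈-filter⁻; ∈-concat⁺′; ∈-allFin)
open import Data.List.Membership.Propositional.Properties.WithK using (unique∧set⇒bag)
open import Data.List.Relation.Binary.BagAndSetEquality using (∼bag⇒↭)
open import Data.List.Relation.Binary.Disjoint.Propositional using (Disjoint)
open import Data.List.Relation.Binary.Permutation.Propositional.Properties using (↭-length)
open import Data.List.Relation.Unary.All as All using (All; []; _∷_)
open import Data.List.Relation.Unary.All.Properties using (all-filter) renaming (map⁺ to All-map⁺)
open import Data.List.Relation.Unary.AllPairs as AllPairs using ([]; _∷_)
open import Data.List.Relation.Unary.AllPairs.Properties using () renaming (map⁺ to AllPairs-map⁺)
open import Data.List.Relation.Unary.Any using (here; there)
open import Data.List.Relation.Unary.Unique.Propositional using (Unique)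
open import Data.List.Relation.Unary.Unique.Propositional.Properties
  using (filter⁺; concat⁺; allFin⁺) renaming (map⁺ to Unique-map⁺)
open import Data.Nat using (ℕ; zero; suc; _+_; _∸_; _*_; _<_; _≤_; _≥_; _≡ᵇ_; _≤ᵇ_; _<ᵇ_; z≤n; s≤s)
open import Data.Nat.DivMod using (_mod_; _%_; m%n<n; m<n⇒m%n≡m)
open import Data.Nat.Properties
  using (+-0-commutativeMonoid; ≡ᵇ⇒≡; ≡⇒≡ᵇ; ≤ᵇ⇒≤; ≤⇒≤ᵇ; <ᵇ⇒<; <⇒<ᵇ; suc-injective;
         ≤-refl; ≤-reflexive; ≤-trans; ≤-pred; <-irrefl; <-trans; <-asym; <-cmp; <⇒≤; <⇒≱; ≤⇒≯; ≰⇒>; ≮⇒≥; ≤∧≢⇒<;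
         n≤1+n; m≤n⇒m≤1+n; m≤m+n; m≤n+m; +-comm; +-assoc; +-suc; +-identityʳ;
         +-mono-≤; +-mono-≤-<; +-monoˡ-≤; +-monoʳ-≤; +-monoʳ-<; +-cancelˡ-≤; +-cancelʳ-≤; +-cancelʳ-<; +-cancelʳ-≡;
         m∸n≤m; ∸-monoˡ-≤; m≤n+m∸n; m≤n+o⇒m∸n≤o; m∸[m∸n]≡n; m+[n∸m]≡n; m∸n+n≡m; m+n∸m≡n)
  renaming (_≟_ to _≟ℕ_)
import Data.Nat.Properties as ℕ
open import Data.Nat.Tactic.RingSolver using (solve-∀)
open import Algebra.Solver.CommutativeMonoid ∧-commutativeMonoid using (solve; _⊕_; _⊜_)
open import Algebra.Properties.CommutativeMonoid.Sum +-0-commutativeMonoid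
  using (sum-syntax; sum-cong-≗; sum-remove; ∑-distrib-+; sum-replicate-zero)
open import Data.Product using (_×_; _,_; proj₁; proj₂; Σ-syntax)
open import Data.Sum using (_⊎_; inj₁; inj₂; [_,_]′)
import Data.Sum as Sum
open import Data.Unit using (tt)
open import Data.Vec using (Vec; []; _∷_; lookup; map; tabulate)
open import Data.Vec.Properties using (lookup-map; lookup∘tabulate; tabulate∘lookup; tabulate-cong; ∷-injective; ∷-injectiveʳ)
open import Function using (_∘_; id; case_of_)
open import Function.Bundles using (_⇔_; mk⇔; Equivalence)
open import Function.Definitions using (Injective)
open import Function.Properties.Equivalence using () renaming (refl to ⇔-refl; sym to ⇔-sym; trans to ⇔-trans)
open import Relation.Binary.Definitions using (DecidableEquality; tri<; tri≈; tri>)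
open import Relation.Binary.PropositionalEquality
  using (_≡_; _≢_; _≗_; refl; sym; trans; cong; cong₂; subst; subst₂; module ≡-Reasoning)
open import Relation.Nullary using (¬_; contradiction; yes; no)
open import Relation.Nullary.Decidable using (⌊_⌋; toWitness; fromWitness; toWitnessFalse; fromWitnessFalse)

open Equivalence using (to; from)

-- Total cyclic orders

record IsTotalCyclicOrder {A : Set} (Z : A → A → A → Set) : Set where
  field
    distinct   : ∀ {x y z} → Z x y z → x ≢ y × y ≢ z × x ≢ z
    cyclic     : ∀ {x y z} → Z x y z → Z y z x
    asymmetric : ∀ {x y z} → Z x y z → ¬ Z z y x
    transitive : ∀ {x y z u} → Z x y z → Z x z u → Z x y u
    total      : ∀ {x y z} → x ≢ y → y ≢ z → x ≢ z → Z x y z ⊎ Z z y x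

isTotalCyclicOrder-⇔ : ∀ {A : Set} {Z Z′ : A → A → A → Set} →
  (∀ {x y z} → Z x y z ⇔ Z′ x y z) → IsTotalCyclicOrder Z′ → IsTotalCyclicOrder Z
isTotalCyclicOrder-⇔ Z⇔Z′ isZ′ = record
  { distinct   = distinct ∘ to Z⇔Z′
  ; cyclic     = from Z⇔Z′ ∘ cyclic ∘ to Z⇔Z′
  ; asymmetric = λ Zxyz Zzyx → asymmetric (to Z⇔Z′ Zxyz) (to Z⇔Z′ Zzyx)
  ; transitive = λ Zxyz Zxzu → from Z⇔Z′ (transitive (to Z⇔Z′ Zxyz) (to Z⇔Z′ Zxzu))
  ; total      = λ x≢y y≢z x≢z → Sum.map (from Z⇔Z′) (from Z⇔Z′) (total x≢y y≢z x≢z)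
  }
  where open IsTotalCyclicOrder isZ′

total-cyclic-⊆⇒⊇ : ∀ {A : Set} {Z Z′ : A → A → A → Set} → IsTotalCyclicOrder Z → IsTotalCyclicOrder Z′ →
  (∀ {x y z} → Z′ x y z → Z x y z) → ∀ {x y z} → Z x y z → Z′ x y z
total-cyclic-⊆⇒⊇ isZ isZ′ Z′⊆Z Zxyz with IsTotalCyclicOrder.distinct isZ Zxyz
... | x≢y , y≢z , x≢z with IsTotalCyclicOrder.total isZ′ x≢y y≢z x≢z
...   | inj₁ Z′xyz = Z′xyz
...   | inj₂ Z′zyx = ⊥-elim (IsTotalCyclicOrder.asymmetric isZ Zxyz (Z′⊆Z Z′zyx))

Cyclic : {A : Set} → (A → A → Set) → A → A → A → Set
Cyclic _<_ x y z = (x < y × y < z) ⊎ (y < z × z < x) ⊎ (z < x × x < y)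

cyclic-mono : ∀ {A : Set} {R S : A → A → Set} → (∀ {x y} → R x y → S x y) →
  ∀ {x y z} → Cyclic R x y z → Cyclic S x y z
cyclic-mono R⇒S (inj₁ (r₁ , r₂))        = inj₁ (R⇒S r₁ , R⇒S r₂)
cyclic-mono R⇒S (inj₂ (inj₁ (r₁ , r₂))) = inj₂ (inj₁ (R⇒S r₁ , R⇒S r₂))
cyclic-mono R⇒S (inj₂ (inj₂ (r₁ , r₂))) = inj₂ (inj₂ (R⇒S r₁ , R⇒S r₂))

module StrictLinearOrder {A : Set} {_<_ : A → A → Set}
  (irrefl : ∀ {x} → ¬ x < x)
  (trans : ∀ {x y z} → x < y → y < z → x < z)
  (connected : ∀ {x y} → x ≢ y → x < y ⊎ y < x) where

  private
    asym : ∀ {x y} → x < y → ¬ y < x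
    asym x<y y<x = irrefl (trans x<y y<x)

    <⇒≢ : ∀ {x y} → x < y → x ≢ y
    <⇒≢ x<y refl = irrefl x<y

  cyclic-distinct : ∀ {x y z} → Cyclic _<_ x y z → x ≢ y × y ≢ z × x ≢ z
  cyclic-distinct (inj₁ (x<y , y<z)) = <⇒≢ x<y , <⇒≢ y<z , <⇒≢ (trans x<y y<z)
  cyclic-distinct (inj₂ (inj₁ (y<z , z<x))) =
    (λ x≡y → <⇒≢ (trans y<z z<x) (sym x≡y)) , <⇒≢ y<z , (λ x≡z → <⇒≢ z<x (sym x≡z))
  cyclic-distinct (inj₂ (inj₂ (z<x , x<y))) =
    <⇒≢ x<y , (λ y≡z → <⇒≢ (trans z<x x<y) (sym y≡z)) , (λ x≡z → <⇒≢ z<x (sym x≡z))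

  cyclic-rotate : ∀ {x y z} → Cyclic _<_ x y z → Cyclic _<_ y z x
  cyclic-rotate (inj₁ p) = inj₂ (inj₂ p)
  cyclic-rotate (inj₂ (inj₁ p)) = inj₁ p
  cyclic-rotate (inj₂ (inj₂ p)) = inj₂ (inj₁ p)

  cyclic-asym : ∀ {x y z} → Cyclic _<_ x y z → ¬ Cyclic _<_ z y x
  cyclic-asym (inj₁ (x<y , y<z)) (inj₁ (z<y , _)) = asym y<z z<y
  cyclic-asym (inj₁ (x<y , y<z)) (inj₂ (inj₁ (y<x , _))) = asym x<y y<x
  cyclic-asym (inj₁ (x<y , y<z)) (inj₂ (inj₂ (x<z , z<y))) = asym y<z z<y
  cyclic-asym (inj₂ (inj₁ (y<z , z<x))) (inj₁ (z<y , _)) = asym y<z z<y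
  cyclic-asym (inj₂ (inj₁ (y<z , z<x))) (inj₂ (inj₁ (y<x , x<z))) = asym z<x x<z
  cyclic-asym (inj₂ (inj₁ (y<z , z<x))) (inj₂ (inj₂ (x<z , _))) = asym z<x x<z
  cyclic-asym (inj₂ (inj₂ (z<x , x<y))) (inj₁ (_ , y<x)) = asym x<y y<x
  cyclic-asym (inj₂ (inj₂ (z<x , x<y))) (inj₂ (inj₁ (y<x , _))) = asym x<y y<x
  cyclic-asym (inj₂ (inj₂ (z<x , x<y))) (inj₂ (inj₂ (x<z , _))) = asym z<x x<z

  cyclic-trans : ∀ {x y z u} → Cyclic _<_ x y z → Cyclic _<_ x z u → Cyclic _<_ x y u
  cyclic-trans (inj₁ (x<y , y<z)) (inj₁ (_ , z<u)) = inj₁ (x<y , trans y<z z<u)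
  cyclic-trans (inj₁ (x<y , y<z)) (inj₂ (inj₁ (_ , u<x))) = inj₂ (inj₂ (u<x , x<y))
  cyclic-trans (inj₁ (x<y , y<z)) (inj₂ (inj₂ (u<x , _))) = inj₂ (inj₂ (u<x , x<y))
  cyclic-trans (inj₂ (inj₁ (y<z , z<x))) (inj₁ (x<z , _)) = ⊥-elim (asym z<x x<z)
  cyclic-trans (inj₂ (inj₁ (y<z , z<x))) (inj₂ (inj₁ (z<u , u<x))) = inj₂ (inj₁ (trans y<z z<u , u<x))
  cyclic-trans (inj₂ (inj₁ (y<z , z<x))) (inj₂ (inj₂ (_ , x<z))) = ⊥-elim (asym z<x x<z)
  cyclic-trans (inj₂ (inj₂ (z<x , x<y))) (inj₁ (x<z , _)) = ⊥-elim (asym z<x x<z)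
  cyclic-trans (inj₂ (inj₂ (z<x , x<y))) (inj₂ (inj₁ (_ , u<x))) = inj₂ (inj₂ (u<x , x<y))
  cyclic-trans (inj₂ (inj₂ (z<x , x<y))) (inj₂ (inj₂ (_ , x<z))) = ⊥-elim (asym z<x x<z)

  cyclic-total : ∀ {x y z} → x ≢ y → y ≢ z → x ≢ z → Cyclic _<_ x y z ⊎ Cyclic _<_ z y x
  cyclic-total {x} {y} {z} x≢y y≢z x≢z with connected x≢y | connected y≢z | connected x≢z
  ... | inj₁ x<y | inj₁ y<z | _ = inj₁ (inj₁ (x<y , y<z))
  ... | inj₁ x<y | inj₂ z<y | inj₁ x<z = inj₂ (inj₂ (inj₂ (x<z , z<y)))
  ... | inj₁ x<y | inj₂ z<y | inj₂ z<x = inj₁ (inj₂ (inj₂ (z<x , x<y)))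
  ... | inj₂ y<x | inj₁ y<z | inj₁ x<z = inj₂ (inj₂ (inj₁ (y<x , x<z)))
  ... | inj₂ y<x | inj₁ y<z | inj₂ z<x = inj₁ (inj₂ (inj₁ (y<z , z<x)))
  ... | inj₂ y<x | inj₂ z<y | _ = inj₂ (inj₁ (z<y , y<x))

  cyclic-isTotalCyclicOrder : IsTotalCyclicOrder (Cyclic _<_)
  cyclic-isTotalCyclicOrder = record
    { distinct = cyclic-distinct ; cyclic = cyclic-rotate ; asymmetric = cyclic-asym
    ; transitive = cyclic-trans ; total = cyclic-total }

cut : {A : Set} → (A → A → A → Set) → A → A → A → Set
cut Z c x y = Z c x y ⊎ (x ≢ c × y ≡ c)

cut-⇔ : ∀ {A : Set} {Z Z′ : A → A → A → Set} → (∀ {x y z} → Z x y z ⇔ Z′ x y z) →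
  ∀ {c x y} → cut Z c x y ⇔ cut Z′ c x y
cut-⇔ Z⇔Z′ = mk⇔ (Sum.map₁ (to Z⇔Z′)) (Sum.map₁ (from Z⇔Z′))

module Cut {A : Set} (_≟_ : DecidableEquality A) {Z : A → A → A → Set} (isZ : IsTotalCyclicOrder Z) (c : A) where
  open IsTotalCyclicOrder isZ

  infix 4 _⊏_
  _⊏_ : A → A → Set
  _⊏_ = cut Z c

  ⊏-irrefl : ∀ {x} → ¬ x ⊏ x
  ⊏-irrefl (inj₁ Zcxx) = proj₁ (proj₂ (distinct Zcxx)) refl
  ⊏-irrefl (inj₂ (x≢c , x≡c)) = x≢c x≡c

  ¬c⊏ : ∀ {x} → ¬ c ⊏ x
  ¬c⊏ (inj₁ Zccx) = proj₁ (distinct Zccx) refl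
  ¬c⊏ (inj₂ (c≢c , _)) = c≢c refl

  ⊏-trans : ∀ {x y z} → x ⊏ y → y ⊏ z → x ⊏ z
  ⊏-trans (inj₁ Zcxy) (inj₁ Zcyz) = inj₁ (transitive Zcxy Zcyz)
  ⊏-trans (inj₁ Zcxy) (inj₂ (_ , z≡c)) = inj₂ ((λ x≡c → proj₁ (distinct Zcxy) (sym x≡c)) , z≡c)
  ⊏-trans (inj₂ (_ , refl)) c⊏z = ⊥-elim (¬c⊏ c⊏z)

  ⊏-connected : ∀ {x y} → x ≢ y → x ⊏ y ⊎ y ⊏ x
  ⊏-connected {x} {y} x≢y with x ≟ c | y ≟ c
  ... | yes x≡c | yes y≡c = ⊥-elim (x≢y (trans x≡c (sym y≡c)))
  ... | yes x≡c | no y≢c = inj₂ (inj₂ (y≢c , x≡c))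
  ... | no x≢c | yes y≡c = inj₁ (inj₂ (x≢c , y≡c))
  ... | no x≢c | no y≢c with total (x≢c ∘ sym) x≢y (y≢c ∘ sym)
  ...   | inj₁ Zcxy = inj₁ (inj₁ Zcxy)
  ...   | inj₂ Zyxc = inj₂ (inj₁ (cyclic (cyclic Zyxc)))

  ⊏-max : ∀ {x} → x ≢ c → x ⊏ c
  ⊏-max x≢c = inj₂ (x≢c , refl)

  private
    ⊏-⊏⇒Z : ∀ {x y z} → x ⊏ y → y ⊏ z → Z x y z
    ⊏-⊏⇒Z (inj₁ Zcxy) (inj₁ Zcyz) with distinct Zcxy | distinct Zcyz | distinct (transitive Zcxy Zcyz)
    ... | _ , x≢y , _ | _ , y≢z , _ | _ , x≢z , _ with total x≢y y≢z x≢z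
    ...   | inj₁ Zxyz = Zxyz
    ...   | inj₂ Zzyx = ⊥-elim (asymmetric Zcxy (transitive (cyclic Zzyx) (cyclic Zcyz)))
    ⊏-⊏⇒Z (inj₁ Zcxy) (inj₂ (_ , refl)) = cyclic Zcxy
    ⊏-⊏⇒Z (inj₂ (_ , refl)) c⊏z = ⊥-elim (¬c⊏ c⊏z)

  cut-cyclic⁻ : ∀ {x y z} → Cyclic _⊏_ x y z → Z x y z
  cut-cyclic⁻ (inj₁ (x⊏y , y⊏z)) = ⊏-⊏⇒Z x⊏y y⊏z
  cut-cyclic⁻ (inj₂ (inj₁ (y⊏z , z⊏x))) = cyclic (cyclic (⊏-⊏⇒Z y⊏z z⊏x))
  cut-cyclic⁻ (inj₂ (inj₂ (z⊏x , x⊏y))) = cyclic (⊏-⊏⇒Z z⊏x x⊏y)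

  cut-cyclic⁺ : ∀ {x y z} → Z x y z → Cyclic _⊏_ x y z
  cut-cyclic⁺ = total-cyclic-⊆⇒⊇ isZ (cyclic-isTotalCyclicOrder) cut-cyclic⁻
    where open StrictLinearOrder ⊏-irrefl ⊏-trans ⊏-connected

module _ {A : Set} (_≟_ : DecidableEquality A) {_<_ : A → A → Set}
  (irrefl : ∀ {x} → ¬ x < x) (trans< : ∀ {x y z} → x < y → y < z → x < z)
  {c : A} (c-max : ∀ {y} → y ≢ c → y < c) where

  private
    ¬c< : ∀ {x} → ¬ c < x
    ¬c< {x} c<x = irrefl (trans< c<x (c-max (λ x≡c → irrefl (subst (c <_) x≡c c<x))))

  cut-at-maximum : ∀ {x y} → cut (Cyclic _<_) c x y ⇔ x < y
  cut-at-maximum {x} {y} = mk⇔ ⇒ ⇐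
    where
    ⇒ : cut (Cyclic _<_) c x y → x < y
    ⇒ (inj₁ (inj₁ (c<x , _)))        = ⊥-elim (¬c< c<x)
    ⇒ (inj₁ (inj₂ (inj₁ (x<y , _)))) = x<y
    ⇒ (inj₁ (inj₂ (inj₂ (_ , c<x)))) = ⊥-elim (¬c< c<x)
    ⇒ (inj₂ (x≢c , refl))            = c-max x≢c
    ⇐ : x < y → cut (Cyclic _<_) c x y
    ⇐ x<y with y ≟ c
    ... | yes refl = inj₂ ((λ x≡c → ¬c< (subst (_< c) x≡c x<y)) , refl)
    ... | no y≢c   = inj₁ (inj₂ (inj₁ (x<y , c-max y≢c)))

T-⇔⇒≡ : ∀ {a b} → (T a ⇔ T b) → a ≡ b
T-⇔⇒≡ {false} {false} _   = refl
T-⇔⇒≡ {false} {true}  a⇔b = ⊥-elim (from a⇔b tt)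
T-⇔⇒≡ {true}  {false} a⇔b = ⊥-elim (to a⇔b tt)
T-⇔⇒≡ {true}  {true}  _   = refl

T-⇒ᵇ : ∀ {a b} → T (a ⇒ᵇ b) ⇔ (T a → T b)
T-⇒ᵇ {false} = mk⇔ (λ _ ()) (λ _ → tt)
T-⇒ᵇ {true}  = mk⇔ (λ b _ → b) (λ f → f tt)

T-∀ᶠ : ∀ {m} {p : Fin m → Bool} → T (∀ᶠ p) ⇔ (∀ i → T (p i))
T-∀ᶠ {m} {p} = T-foldr-∧-tabulate (λ i → i)
  where
  T-foldr-∧-tabulate : ∀ {n} (f : Fin n → Fin m) →
    T (List.foldr (λ i b → p i ∧ b) true (List.tabulate f)) ⇔ (∀ i → T (p (f i)))
  T-foldr-∧-tabulate {zero}  f = mk⇔ (λ _ ()) (λ _ → tt)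
  T-foldr-∧-tabulate {suc n} f = mk⇔
    (λ h → let (h₀ , hₛ) = to (T-∧ {p (f zero)}) h in
           λ { zero → h₀ ; (suc i) → to (T-foldr-∧-tabulate (f ∘ suc)) hₛ i })
    (λ h → from T-∧ (h zero , from (T-foldr-∧-tabulate (f ∘ suc)) (h ∘ suc)))

T-neq : ∀ {m} {x y : Fin m} → T (neq x y) ⇔ x ≢ y
T-neq = mk⇔ toWitnessFalse fromWitnessFalse

T-distinct3 : ∀ {m} {x y z : Fin m} → T (distinct3 x y z) ⇔ (x ≢ y × y ≢ z × x ≢ z)
T-distinct3 {x = x} {y} {z} = mk⇔
  (λ h → let (h₁ , h₂₃) = to (T-∧ {neq x y}) h
             (h₂ , h₃) = to (T-∧ {neq y z}) h₂₃
         in to T-neq h₁ , to T-neq h₂ , to T-neq h₃)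
  (λ (x≢y , y≢z , x≢z) → from T-∧ (from T-neq x≢y , from T-∧ (from T-neq y≢z , from T-neq x≢z)))

T-not : ∀ {b} → T (not b) ⇔ (¬ T b)
T-not {false} = mk⇔ (λ _ ()) (λ _ → tt)
T-not {true}  = mk⇔ (λ ()) (λ ¬t → ¬t tt)

⟦_⟧ : ∀ {m} → Cube m → Fin m → Fin m → Fin m → Set
⟦ Z ⟧ x y z = T (Z ∋⟨ x , y , z ⟩)

module _ {m} {Z : Cube m} where
  private
    distinctᵇ cyclicᵇ asymmetricᵇ transitiveᵇ totalᵇ : Fin m → Fin m → Fin m → Fin m → Bool
    distinctᵇ   x y z u = Z ∋⟨ x , y , z ⟩ ⇒ᵇ distinct3 x y z
    cyclicᵇ     x y z u = Z ∋⟨ x , y , z ⟩ ⇒ᵇ Z ∋⟨ y , z , x ⟩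
    asymmetricᵇ x y z u = Z ∋⟨ x , y , z ⟩ ⇒ᵇ not (Z ∋⟨ z , y , x ⟩)
    transitiveᵇ x y z u = (Z ∋⟨ x , y , z ⟩ ∧ Z ∋⟨ x , z , u ⟩) ⇒ᵇ Z ∋⟨ x , y , u ⟩
    totalᵇ      x y z u = distinct3 x y z ⇒ᵇ (Z ∋⟨ x , y , z ⟩ ∨ Z ∋⟨ z , y , x ⟩)

  isTotalCyclicOrder⇒IsTotalCyclicOrder : T (isTotalCyclicOrder Z) → IsTotalCyclicOrder ⟦ Z ⟧
  isTotalCyclicOrder⇒IsTotalCyclicOrder h = record
    { distinct   = λ {x} {y} {z} → to T-distinct3 ∘ to T-⇒ᵇ (proj₁ (clauses x y z x))
    ; cyclic     = λ {x} {y} {z} → to T-⇒ᵇ (proj₁ (proj₂ (clauses x y z x)))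
    ; asymmetric = λ {x} {y} {z} → to T-not ∘ to T-⇒ᵇ (proj₁ (proj₂ (proj₂ (clauses x y z x))))
    ; transitive = λ {x} {y} {z} {u} Zxyz Zxzu →
        to T-⇒ᵇ (proj₁ (proj₂ (proj₂ (proj₂ (clauses x y z u))))) (from T-∧ (Zxyz , Zxzu))
    ; total      = λ {x} {y} {z} x≢y y≢z x≢z →
        to T-∨ (to T-⇒ᵇ (proj₂ (proj₂ (proj₂ (proj₂ (clauses x y z x))))) (from T-distinct3 (x≢y , y≢z , x≢z)))
    }
    where
    clauses : ∀ x y z u → T (distinctᵇ x y z u) × T (cyclicᵇ x y z u) × T (asymmetricᵇ x y z u)
                          × T (transitiveᵇ x y z u) × T (totalᵇ x y z u)
    clauses x y z u =
      let h₁ , h₂₃₄₅ = to (T-∧ {distinctᵇ x y z u}) (to T-∀ᶠ (to T-∀ᶠ (to T-∀ᶠ (to T-∀ᶠ h x) y) z) u)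
          h₂ , h₃₄₅ = to (T-∧ {cyclicᵇ x y z u}) h₂₃₄₅
          h₃ , h₄₅ = to (T-∧ {asymmetricᵇ x y z u}) h₃₄₅
          h₄ , h₅ = to (T-∧ {transitiveᵇ x y z u}) h₄₅
      in h₁ , h₂ , h₃ , h₄ , h₅

  IsTotalCyclicOrder⇒isTotalCyclicOrder : IsTotalCyclicOrder ⟦ Z ⟧ → T (isTotalCyclicOrder Z)
  IsTotalCyclicOrder⇒isTotalCyclicOrder isZ = from T-∀ᶠ λ x → from T-∀ᶠ λ y → from T-∀ᶠ λ z → from T-∀ᶠ (clauses x y z)
    where
    open IsTotalCyclicOrder isZ
    clauses : ∀ x y z u → T (distinctᵇ x y z u ∧ cyclicᵇ x y z u ∧ asymmetricᵇ x y z u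
                             ∧ transitiveᵇ x y z u ∧ totalᵇ x y z u)
    clauses x y z u =
        from T-∧ (from T-⇒ᵇ (from T-distinct3 ∘ distinct)
      , from T-∧ (from T-⇒ᵇ cyclic
      , from T-∧ (from T-⇒ᵇ (from T-not ∘ asymmetric)
      , from T-∧ (from T-⇒ᵇ (λ h → let Zxyz , Zxzu = to (T-∧ {Z ∋⟨ x , y , z ⟩}) h in transitive Zxyz Zxzu)
      , from (T-⇒ᵇ {distinct3 x y z}) (λ d → let x≢y , y≢z , x≢z = to T-distinct3 d in from T-∨ (total x≢y y≢z x≢z))))))

  T-isTotalCyclicOrder : T (isTotalCyclicOrder Z) ⇔ IsTotalCyclicOrder ⟦ Z ⟧
  T-isTotalCyclicOrder = mk⇔ isTotalCyclicOrder⇒IsTotalCyclicOrder IsTotalCyclicOrder⇒isTotalCyclicOrder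

T-≡ᵇ : ∀ m n → T (m ≡ᵇ n) ⇔ m ≡ n
T-≡ᵇ m n = mk⇔ (≡ᵇ⇒≡ m n) (≡⇒≡ᵇ m n)

T-≤ᵇ : ∀ m n → T (m ≤ᵇ n) ⇔ m ≤ n
T-≤ᵇ m n = mk⇔ (≤ᵇ⇒≤ m n) ≤⇒≤ᵇ

T-<ᵇ : ∀ m n → T (m <ᵇ n) ⇔ m < n
T-<ᵇ m n = mk⇔ (<ᵇ⇒< m n) <⇒<ᵇ

𝟙 : Bool → ℕ
𝟙 b = if b then 1 else 0

module _ {A : Set} where

  count-∷ : ∀ (p : A → Bool) x xs → count p (x ∷ xs) ≡ 𝟙 (p x) + count p xs
  count-∷ p x xs with p x
  ... | true  = refl
  ... | false = refl

  count-cong : ∀ {p q : A → Bool} → p ≗ q → ∀ xs → count p xs ≡ count q xs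
  count-cong p≗q []       = refl
  count-cong {p} {q} p≗q (x ∷ xs) = begin
    count p (x ∷ xs)         ≡⟨ count-∷ p x xs ⟩
    𝟙 (p x) + count p xs     ≡⟨ cong₂ _+_ (cong 𝟙 (p≗q x)) (count-cong p≗q xs) ⟩
    𝟙 (q x) + count q xs     ≡⟨ count-∷ q x xs ⟨
    count q (x ∷ xs)         ∎
    where open ≡-Reasoning

  count-++ : ∀ (p : A → Bool) xs ys → count p (xs ++ ys) ≡ count p xs + count p ys
  count-++ p xs ys = trans (cong length (filter-++ (T? ∘ p) xs ys)) (length-++ (filter (T? ∘ p) xs))

  count-∧ˡ : ∀ b (p : A → Bool) xs → count (λ x → b ∧ p x) xs ≡ 𝟙 b * count p xs
  count-∧ˡ true  p xs = sym (+-identityʳ (count p xs))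
  count-∧ˡ false p []       = refl
  count-∧ˡ false p (x ∷ xs) = count-∧ˡ false p xs

module _ {A B : Set} where

  count-map : ∀ (p : B → Bool) (f : A → B) xs → count p (List.map f xs) ≡ count (p ∘ f) xs
  count-map p f []       = refl
  count-map p f (x ∷ xs) = begin
    count p (f x ∷ List.map f xs)        ≡⟨ count-∷ p (f x) (List.map f xs) ⟩
    𝟙 (p (f x)) + count p (List.map f xs) ≡⟨ cong (𝟙 (p (f x)) +_) (count-map p f xs) ⟩
    𝟙 (p (f x)) + count (p ∘ f) xs   ≡⟨ count-∷ (p ∘ f) x xs ⟨
    count (p ∘ f) (x ∷ xs)           ∎
    where open ≡-Reasoning

  count-concatMap-tabulate : ∀ {n} (p : B → Bool) (f : A → List B) (g : Fin n → A) →
    count p (concatMap f (List.tabulate g)) ≡ ∑[ i < n ] count p (f (g i))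
  count-concatMap-tabulate {zero}  p f g = refl
  count-concatMap-tabulate {suc n} p f g =
    trans (count-++ p (f (g zero)) _) (cong (count p (f (g zero)) +_) (count-concatMap-tabulate p f (g ∘ suc)))

count-tabulate : ∀ {A : Set} {n} (p : A → Bool) (g : Fin n → A) →
  count p (List.tabulate g) ≡ ∑[ i < n ] 𝟙 (p (g i))
count-tabulate {n = zero}  p g = refl
count-tabulate {n = suc n} p g = trans (count-∷ p (g zero) _) (cong (𝟙 (p (g zero)) +_) (count-tabulate p (g ∘ suc)))

count-vecs : ∀ {N k} (p : Vec (Fin N) (suc k) → Bool) →
  count p (vecs (allFin N) (suc k)) ≡ ∑[ x < N ] count (λ ρ → p (x ∷ ρ)) (vecs (allFin N) k)
count-vecs {N} {k} p = trans (count-concatMap-tabulate p (λ x → List.map (x ∷_) (vecs (allFin N) k)) id)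
                             (sum-cong-≗ (λ x → count-map p (x ∷_) (vecs (allFin N) k)))

∑-zero : ∀ {n} {f : Fin n → ℕ} → (∀ i → f i ≡ 0) → ∑[ i < n ] f i ≡ 0
∑-zero {n} f≗0 = trans (sum-cong-≗ f≗0) (sum-replicate-zero n)

∑-𝟙-unique : ∀ {n} (q : Fin n → Bool) (j : Fin n) → (∀ i → T (q i) → i ≡ j) →
  ∑[ i < n ] 𝟙 (q i) ≡ 𝟙 (q j)
∑-𝟙-unique {suc n} q j only-j = begin
  ∑[ i < suc n ] 𝟙 (q i)                   ≡⟨ sum-remove {i = j} (𝟙 ∘ q) ⟩
  𝟙 (q j) + ∑[ i < n ] 𝟙 (q (punchIn j i)) ≡⟨ cong (𝟙 (q j) +_) (∑-zero off-j) ⟩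
  𝟙 (q j) + 0                              ≡⟨ +-identityʳ _ ⟩
  𝟙 (q j)                                  ∎
  where
  open ≡-Reasoning
  off-j : ∀ i → 𝟙 (q (punchIn j i)) ≡ 0
  off-j i with q (punchIn j i) in eq
  ... | true  = contradiction (only-j _ (subst T (sym eq) _)) (punchInᵢ≢i j i)
  ... | false = refl

∑-count : ∀ {A : Set} {n} (B : Fin n → A → Bool) (C : A → Bool) →
  (∀ x → ∑[ i < n ] 𝟙 (B i x) ≡ 𝟙 (C x)) → ∀ xs → ∑[ i < n ] count (B i) xs ≡ count C xs
∑-count {n = n} B C fibre [] = ∑-zero {n} (λ _ → refl)
∑-count {n = n} B C fibre (x ∷ xs) = begin
  ∑[ i < n ] count (B i) (x ∷ xs)                           ≡⟨ sum-cong-≗ (λ i → count-∷ (B i) x xs) ⟩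
  ∑[ i < n ] (𝟙 (B i x) + count (B i) xs)                   ≡⟨ ∑-distrib-+ (λ i → 𝟙 (B i x)) _ ⟩
  ∑[ i < n ] 𝟙 (B i x) + ∑[ i < n ] count (B i) xs          ≡⟨ cong₂ _+_ (fibre x) (∑-count B C fibre xs) ⟩
  𝟙 (C x) + count C xs                                      ≡⟨ count-∷ C x xs ⟨
  count C (x ∷ xs)                                          ∎
  where open ≡-Reasoning

count-by-value : ∀ {A : Set} K (P : A → Bool) (s : A → ℕ) (R : ℕ → Bool) →
  (∀ x → T (P x) → s x < K) → ∀ xs →
  count (λ x → P x ∧ R (s x)) xs ≡ ∑[ t < K ] (𝟙 (R (toℕ t)) * count (λ x → P x ∧ (s x ≡ᵇ toℕ t)) xs)
count-by-value K P s R bound xs = sym (begin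
  ∑[ t < K ] (𝟙 (R (toℕ t)) * count (λ x → P x ∧ (s x ≡ᵇ toℕ t)) xs)
    ≡⟨ sum-cong-≗ {K} (λ t → count-∧ˡ (R (toℕ t)) _ xs) ⟨
  ∑[ t < K ] count (λ x → R (toℕ t) ∧ (P x ∧ (s x ≡ᵇ toℕ t))) xs
    ≡⟨ ∑-count {n = K} (λ t x → R (toℕ t) ∧ (P x ∧ (s x ≡ᵇ toℕ t))) (λ x → P x ∧ R (s x)) fibre xs ⟩
  count (λ x → P x ∧ R (s x)) xs ∎)
  where
  open ≡-Reasoning
  fibre : ∀ x → ∑[ t < K ] 𝟙 (R (toℕ t) ∧ (P x ∧ (s x ≡ᵇ toℕ t))) ≡ 𝟙 (P x ∧ R (s x))
  fibre x with P x in eq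
  ... | false = ∑-zero {K} (λ t → cong 𝟙 (∧-zeroʳ (R (toℕ t))))
  ... | true  = trans (∑-𝟙-unique _ t₀ only-t₀) (cong 𝟙 value-at-t₀)
    where
    s<K = bound x (subst T (sym eq) _)
    t₀ : Fin K
    t₀ = fromℕ< s<K
    only-t₀ : ∀ t → T (R (toℕ t) ∧ (s x ≡ᵇ toℕ t)) → t ≡ t₀
    only-t₀ t h = toℕ-injective (trans (sym (≡ᵇ⇒≡ _ _ (proj₂ (to (T-∧ {R (toℕ t)}) h)))) (sym (toℕ-fromℕ< s<K)))
    value-at-t₀ : R (toℕ t₀) ∧ (s x ≡ᵇ toℕ t₀) ≡ R (s x)
    value-at-t₀ rewrite toℕ-fromℕ< s<K | to (T-≡ {s x ≡ᵇ s x}) (≡⇒≡ᵇ (s x) (s x) refl) = ∧-identityʳ (R (s x))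

∑-𝟙-∧ˡ : ∀ {n} a (B : Fin n → Bool) c → (T a → ∑[ i < n ] 𝟙 (B i) ≡ 𝟙 c) →
  ∑[ i < n ] 𝟙 (a ∧ B i) ≡ 𝟙 (a ∧ c)
∑-𝟙-∧ˡ {n} false B c _ = ∑-zero {n} (λ _ → refl)
∑-𝟙-∧ˡ     true  B c h = h _

count-partition : ∀ {A : Set} K (P : A → Bool) (s : A → ℕ) → (∀ x → T (P x) → s x < K) → ∀ xs →
  count P xs ≡ ∑[ t < K ] count (λ x → P x ∧ (s x ≡ᵇ toℕ t)) xs
count-partition K P s bound xs = begin
  count P xs                                                         ≡⟨ count-cong (λ x → ∧-identityʳ (P x)) xs ⟨
  count (λ x → P x ∧ true) xs                                        ≡⟨ count-by-value K P s (λ _ → true) bound xs ⟩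
  ∑[ t < K ] (1 * count (λ x → P x ∧ (s x ≡ᵇ toℕ t)) xs)             ≡⟨ sum-cong-≗ {K} (λ t → +-identityʳ _) ⟩
  ∑[ t < K ] count (λ x → P x ∧ (s x ≡ᵇ toℕ t)) xs                   ∎
  where open ≡-Reasoning

𝟙-mono : ∀ {a b} → (T a → T b) → 𝟙 a ≤ 𝟙 b
𝟙-mono {false}         _ = z≤n
𝟙-mono {true}  {true}  _ = ≤-refl
𝟙-mono {true}  {false} f = ⊥-elim (f tt)

module _ {A : Set} {p q : A → Bool} (p⇒q : ∀ x → T (p x) → T (q x)) where

  count-mono : ∀ xs → count p xs ≤ count q xs
  count-mono []       = z≤n
  count-mono (x ∷ xs) = subst₂ _≤_ (sym (count-∷ p x xs)) (sym (count-∷ q x xs))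
                               (+-mono-≤ (𝟙-mono (p⇒q x)) (count-mono xs))

  count-mono-< : ∀ {x₀ xs} → x₀ ∈ xs → T (q x₀) → ¬ T (p x₀) → count p xs < count q xs
  count-mono-< {x₀} {x ∷ xs} (here refl) qx₀ ¬px₀ = subst₂ _<_ (sym (count-∷ p x xs)) (sym (count-∷ q x xs))
    (subst₂ (λ a b → a + count p xs < b + count q xs) (sym (𝟙-false ¬px₀)) (sym (𝟙-true qx₀)) (s≤s (count-mono xs)))
    where
    𝟙-false : ∀ {b} → ¬ T b → 𝟙 b ≡ 0
    𝟙-false {false} _ = refl
    𝟙-false {true}  f = ⊥-elim (f tt)
    𝟙-true : ∀ {b} → T b → 𝟙 b ≡ 1
    𝟙-true {true} _ = refl
  count-mono-< {x₀} {x ∷ xs} (there x₀∈xs) qx₀ ¬px₀ = subst₂ _<_ (sym (count-∷ p x xs)) (sym (count-∷ q x xs))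
    (+-mono-≤-< (𝟙-mono (p⇒q x)) (count-mono-< x₀∈xs qx₀ ¬px₀))

∑-𝟙-<ᵇ : ∀ {n} K → K ≤ n → ∑[ w < n ] 𝟙 (toℕ w <ᵇ K) ≡ K
∑-𝟙-<ᵇ {zero}  zero    _         = refl
∑-𝟙-<ᵇ {suc n} zero    _         = ∑-zero {suc n} (λ _ → refl)
∑-𝟙-<ᵇ {suc n} (suc K) (s≤s K≤n) = cong suc (∑-𝟙-<ᵇ K K≤n)

∑-const-1 : ∀ n → ∑[ i < n ] 1 ≡ n
∑-const-1 zero    = refl
∑-const-1 (suc n) = cong suc (∑-const-1 n)

module _ {A B : Set} {xs : List A} {ys : List B}
  (xs-unique : Unique xs) (ys-unique : Unique ys) (xs-complete : ∀ x → x ∈ xs) (ys-complete : ∀ y → y ∈ ys)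
  (p : A → Bool) (q : B → Bool) (f : A → B) (g : B → A)
  (p⇒q : ∀ x → T (p x) → T (q (f x))) (q⇒p : ∀ y → T (q y) → T (p (g y)))
  (g∘f : ∀ x → T (p x) → g (f x) ≡ x) (f∘g : ∀ y → T (q y) → f (g y) ≡ y) where

  private
    unique-image : ∀ {zs} → All (T ∘ p) zs → Unique zs → Unique (List.map f zs)
    unique-image []         []                = []
    unique-image (pz ∷ pzs) (z∉zs ∷ zs-unique) =
      All-map⁺ (All.zipWith (λ (pz′ , z≢z′) fz≡fz′ → z≢z′ (trans (sym (g∘f _ pz)) (trans (cong g fz≡fz′) (g∘f _ pz′))))
                            (pzs , z∉zs))
      ∷ unique-image pzs zs-unique

  count-bijection : count p xs ≡ count q ys
  count-bijection = trans (sym (length-map f (filter (T? ∘ p) xs))) (↭-length (∼bag⇒↭ (unique∧set⇒bag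
    (unique-image (all-filter (T? ∘ p) xs) (filter⁺ (T? ∘ p) xs-unique))
    (filter⁺ (T? ∘ q) ys-unique)
    (mk⇔ image⇒ ⇒image))))
    where
    image⇒ : ∀ {z} → z ∈ List.map f (filter (T? ∘ p) xs) → z ∈ filter (T? ∘ q) ys
    image⇒ z∈ with ∈-map⁻ f z∈
    ... | x , x∈ , refl = ∈-filter⁺ (T? ∘ q) (ys-complete (f x)) (p⇒q x (proj₂ (∈-filter⁻ (T? ∘ p) {xs = xs} x∈)))
    ⇒image : ∀ {z} → z ∈ filter (T? ∘ q) ys → z ∈ List.map f (filter (T? ∘ p) xs)
    ⇒image {z} z∈ = subst (_∈ List.map f (filter (T? ∘ p) xs)) (f∘g z qz)
                          (∈-map⁺ f (∈-filter⁺ (T? ∘ p) (xs-complete (g z)) (q⇒p z qz)))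
      where qz = proj₂ (∈-filter⁻ (T? ∘ q) {xs = ys} z∈)

module _ {A : Set} {xs : List A} where

  vecs-unique : Unique xs → ∀ k → Unique (vecs xs k)
  vecs-unique xs-unique zero    = [] ∷ []
  vecs-unique xs-unique (suc k) = concat⁺
    (All-map⁺ (All.universal (λ x → Unique-map⁺ ∷-injectiveʳ (vecs-unique xs-unique k)) xs))
    (AllPairs-map⁺ (AllPairs.map disjoint-heads xs-unique))
    where
    disjoint-heads : ∀ {x y} → x ≢ y → Disjoint (List.map (x ∷_) (vecs xs k)) (List.map (y ∷_) (vecs xs k))
    disjoint-heads x≢y (v∈x∷ , v∈y∷) with ∈-map⁻ _ v∈x∷ | ∈-map⁻ _ v∈y∷
    ... | _ , _ , refl | _ , _ , x∷u≡y∷w = x≢y (proj₁ (∷-injective x∷u≡y∷w))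

  vecs-complete : (∀ x → x ∈ xs) → ∀ {k} (v : Vec A k) → v ∈ vecs xs k
  vecs-complete xs-complete []      = here refl
  vecs-complete xs-complete (x ∷ v) =
    ∈-concat⁺′ (∈-map⁺ (x ∷_) (vecs-complete xs-complete v)) (∈-map⁺ (λ y → List.map (y ∷_) (vecs xs _)) (xs-complete x))

allCubes-unique : ∀ m → Unique (allCubes m)
allCubes-unique m = vecs-unique (vecs-unique (vecs-unique (((λ ()) ∷ []) ∷ [] ∷ []) m) m) m

allCubes-complete : ∀ {m} (Z : Cube m) → Z ∈ allCubes m
allCubes-complete = vecs-complete (vecs-complete (vecs-complete λ { true → here refl ; false → there (here refl) }))

perms-unique : ∀ n → Unique (vecs (allFin n) n)
perms-unique n = vecs-unique (allFin⁺ n) n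

perms-complete : ∀ {n} (σ : Vec (Fin n) n) → σ ∈ vecs (allFin n) n
perms-complete = vecs-complete ∈-allFin

-- Permutations, built by inserting a first entry

fresh : ∀ {N L} → Fin N → Vec (Fin N) L → Bool
fresh v []       = true
fresh v (x ∷ xs) = neq v x ∧ fresh v xs

distinct : ∀ {N L} → Vec (Fin N) L → Bool
distinct []       = true
distinct (x ∷ xs) = fresh x xs ∧ distinct xs

module _ {M N} {f : Fin M → Fin N} (f-inj : Injective _≡_ _≡_ f) where

  neq-injective : ∀ x y → neq (f x) (f y) ≡ neq x y
  neq-injective x y = T-⇔⇒≡ (mk⇔ (λ h → from T-neq (to T-neq h ∘ cong f))
                                 (λ h → from T-neq (to T-neq h ∘ f-inj)))

  fresh-map : ∀ {L} y (ρ : Vec (Fin M) L) → fresh (f y) (map f ρ) ≡ fresh y ρ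
  fresh-map y []       = refl
  fresh-map y (x ∷ ρ) = cong₂ _∧_ (neq-injective y x) (fresh-map y ρ)

  distinct-map : ∀ {L} (ρ : Vec (Fin M) L) → distinct (map f ρ) ≡ distinct ρ
  distinct-map []      = refl
  distinct-map (x ∷ ρ) = cong₂ _∧_ (fresh-map x ρ) (distinct-map ρ)

neq-punchInᵢ : ∀ {m} (v : Fin (suc m)) y → neq v (punchIn v y) ≡ true
neq-punchInᵢ v y = T-⇔⇒≡ (mk⇔ (λ _ → _) (λ _ → from T-neq (punchInᵢ≢i v y ∘ sym)))

fresh-self : ∀ {N L} (v : Fin N) (ρ : Vec (Fin N) L) → fresh v (v ∷ ρ) ≡ false
fresh-self v ρ = cong (_∧ fresh v ρ) (T-⇔⇒≡ (mk⇔ (λ v≢v → contradiction refl (to T-neq v≢v)) (λ ())))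

count-fresh : ∀ {m} j (v : Fin (suc m)) (P : Vec (Fin (suc m)) j → Bool) →
  count (λ ρ → fresh v ρ ∧ P ρ) (vecs (allFin (suc m)) j) ≡ count (λ ρ → P (map (punchIn v) ρ)) (vecs (allFin m) j)
count-fresh zero    v P = trans (count-∷ (λ ρ → fresh v ρ ∧ P ρ) [] []) (sym (count-∷ (λ ρ → P (map (punchIn v) ρ)) [] []))
count-fresh {m} (suc j) v P = begin
  count (λ ρ → fresh v ρ ∧ P ρ) (vecs (allFin (suc m)) (suc j))
    ≡⟨ count-vecs (λ ρ → fresh v ρ ∧ P ρ) ⟩
  ∑[ x < suc m ] F x
    ≡⟨ sum-remove {i = v} F ⟩
  F v + ∑[ y < m ] F (punchIn v y)
    ≡⟨ cong₂ _+_ F-v (sum-cong-≗ {m} F-punchIn) ⟩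
  0 + ∑[ y < m ] count (λ τ → P (punchIn v y ∷ map (punchIn v) τ)) (vecs (allFin m) j)
    ≡⟨ count-vecs (λ τ → P (map (punchIn v) τ)) ⟨
  count (λ τ → P (map (punchIn v) τ)) (vecs (allFin m) (suc j)) ∎
  where
  open ≡-Reasoning
  F : Fin (suc m) → ℕ
  F x = count (λ ρ → fresh v (x ∷ ρ) ∧ P (x ∷ ρ)) (vecs (allFin (suc m)) j)
  F-v : F v ≡ 0
  F-v = trans (count-cong (λ ρ → cong (_∧ P (v ∷ ρ)) (fresh-self v ρ)) (vecs (allFin (suc m)) j))
              (count-∧ˡ false (λ ρ → P (v ∷ ρ)) (vecs (allFin (suc m)) j))
  F-punchIn : ∀ y → F (punchIn v y) ≡ count (λ τ → P (punchIn v y ∷ map (punchIn v) τ)) (vecs (allFin m) j)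
  F-punchIn y = trans (count-cong (λ ρ → cong (λ b → (b ∧ fresh v ρ) ∧ P (punchIn v y ∷ ρ)) (neq-punchInᵢ v y))
                                  (vecs (allFin (suc m)) j))
                      (count-fresh j v (λ ρ → P (punchIn v y ∷ ρ)))

count-distinct-by-head : ∀ m (P : Vec (Fin (suc m)) (suc m) → Bool) →
  count (λ σ → distinct σ ∧ P σ) (vecs (allFin (suc m)) (suc m)) ≡
  ∑[ v < suc m ] count (λ ρ → distinct ρ ∧ P (v ∷ map (punchIn v) ρ)) (vecs (allFin m) m)
count-distinct-by-head m P = trans (count-vecs (λ σ → distinct σ ∧ P σ)) (sum-cong-≗ {suc m} by-head)
  where
  by-head : ∀ v → count (λ ρ → (fresh v ρ ∧ distinct ρ) ∧ P (v ∷ ρ)) (vecs (allFin (suc m)) m) ≡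
                  count (λ ρ → distinct ρ ∧ P (v ∷ map (punchIn v) ρ)) (vecs (allFin m) m)
  by-head v = begin
    count (λ ρ → (fresh v ρ ∧ distinct ρ) ∧ P (v ∷ ρ)) (vecs (allFin (suc m)) m)
      ≡⟨ count-cong (λ ρ → ∧-assoc (fresh v ρ) (distinct ρ) (P (v ∷ ρ))) (vecs (allFin (suc m)) m) ⟩
    count (λ ρ → fresh v ρ ∧ (distinct ρ ∧ P (v ∷ ρ))) (vecs (allFin (suc m)) m)
      ≡⟨ count-fresh m v (λ ρ → distinct ρ ∧ P (v ∷ ρ)) ⟩
    count (λ ρ → distinct (map (punchIn v) ρ) ∧ P (v ∷ map (punchIn v) ρ)) (vecs (allFin m) m)
      ≡⟨ count-cong (λ ρ → cong (_∧ P (v ∷ map (punchIn v) ρ)) (distinct-map (punchIn-injective v _ _) ρ)) (vecs (allFin m) m) ⟩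
    count (λ ρ → distinct ρ ∧ P (v ∷ map (punchIn v) ρ)) (vecs (allFin m) m) ∎
    where open ≡-Reasoning

T-fresh : ∀ {N L} {v : Fin N} {xs : Vec (Fin N) L} → T (fresh v xs) ⇔ (∀ k → v ≢ lookup xs k)
T-fresh {xs = []}     = mk⇔ (λ _ ()) (λ _ → tt)
T-fresh {v = v} {xs = x ∷ xs} = mk⇔
  (λ h → let v≢x , v∉xs = to (T-∧ {neq v x}) h in
         λ { zero → to T-neq v≢x ; (suc k) → to (T-fresh {xs = xs}) v∉xs k })
  (λ v∉ → from (T-∧ {neq v x}) (from T-neq (v∉ zero) , from (T-fresh {v = v} {xs = xs}) (v∉ ∘ suc)))

T-distinct : ∀ {N L} {σ : Vec (Fin N) L} → T (distinct σ) ⇔ Injective _≡_ _≡_ (lookup σ)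
T-distinct {σ = []}     = mk⇔ (λ _ {i} → case i of λ ()) (λ _ → tt)
T-distinct {σ = x ∷ xs} = mk⇔
  (λ h {i} {j} → let x∉xs , xs-inj = to (T-∧ {fresh x xs}) h in
         injective (to (T-fresh {xs = xs}) x∉xs) (to (T-distinct {σ = xs}) xs-inj) {i} {j})
  (λ inj → from (T-∧ {fresh x xs})
     ( from (T-fresh {v = x} {xs = xs}) (λ k x≡xₖ → contradiction (inj {zero} {suc k} x≡xₖ) λ ())
     , from (T-distinct {σ = xs}) (λ {i} {j} e → Fin-suc-injective (inj {suc i} {suc j} e))))
  where
  injective : (∀ k → x ≢ lookup xs k) → Injective _≡_ _≡_ (lookup xs) → Injective _≡_ _≡_ (lookup (x ∷ xs))
  injective x∉xs xs-inj {zero}  {zero}  _ = refl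
  injective x∉xs xs-inj {zero}  {suc j} e = contradiction e (x∉xs j)
  injective x∉xs xs-inj {suc i} {zero}  e = contradiction (sym e) (x∉xs i)
  injective x∉xs xs-inj {suc i} {suc j} e = cong suc (xs-inj e)

T-isPermutation : ∀ {n} {σ : Vec (Fin n) n} → T (isPermutation σ) ⇔ Injective _≡_ _≡_ (lookup σ)
T-isPermutation {σ = σ} = mk⇔
  (λ h {i} {j} σᵢ≡σⱼ → case i ≟ j of λ
     { (yes i≡j) → i≡j
     ; (no i≢j) → contradiction σᵢ≡σⱼ (to T-neq (to T-⇒ᵇ (to T-∀ᶠ (to T-∀ᶠ h i) j) (from T-neq i≢j))) })
  (λ inj → from T-∀ᶠ λ i → from T-∀ᶠ λ j →
     from (T-⇒ᵇ {neq i j}) (λ i≢j → from T-neq (to T-neq i≢j ∘ inj)))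

isPermutation≡distinct : ∀ {n} (σ : Vec (Fin n) n) → isPermutation σ ≡ distinct σ
isPermutation≡distinct σ = T-⇔⇒≡ (mk⇔ (λ h → from (T-distinct {σ = σ}) (to (T-isPermutation {σ = σ}) h))
                                        (λ h → from (T-isPermutation {σ = σ}) (to (T-distinct {σ = σ}) h)))

fresh⇒punchIn-image : ∀ {m L} (v : Fin (suc m)) (ρ : Vec (Fin (suc m)) L) → T (fresh v ρ) →
  Σ[ ρ′ ∈ Vec (Fin m) L ] map (punchIn v) ρ′ ≡ ρ
fresh⇒punchIn-image v []      _ = [] , refl
fresh⇒punchIn-image v (x ∷ ρ) h =
  let v≢x , v∉ρ = to (T-∧ {neq v x}) h
      ρ′ , ρ′↦ρ = fresh⇒punchIn-image v ρ v∉ρ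
  in punchOut (to T-neq v≢x) ∷ ρ′ , cong₂ _∷_ (punchIn-punchOut _) ρ′↦ρ

∑-permute : ∀ {m} (τ : Vec (Fin m) m) → T (distinct τ) → (F : Fin m → ℕ) →
  ∑[ i < m ] F (lookup τ i) ≡ ∑[ i < m ] F i
∑-permute []      _ F = refl
∑-permute {suc m} (v ∷ ρ) h F with to (T-∧ {fresh v ρ}) h
... | v∉ρ , ρ-distinct with fresh⇒punchIn-image v ρ v∉ρ
... | ρ′ , refl = begin
  F v + ∑[ i < m ] F (lookup (map (punchIn v) ρ′) i) ≡⟨ cong (F v +_) (sum-cong-≗ {m} λ i → cong F (lookup-map i (punchIn v) ρ′)) ⟩
  F v + ∑[ i < m ] F (punchIn v (lookup ρ′ i))       ≡⟨ cong (F v +_) (∑-permute ρ′ ρ′-distinct (F ∘ punchIn v)) ⟩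
  F v + ∑[ i < m ] F (punchIn v i)                   ≡⟨ sum-remove {i = v} F ⟨
  ∑[ i < suc m ] F i                                 ∎
  where
  open ≡-Reasoning
  ρ′-distinct : T (distinct ρ′)
  ρ′-distinct = subst T (distinct-map (punchIn-injective v _ _) ρ′) ρ-distinct

count-below-injective : ∀ {m} (τ : Vec (Fin m) m) → T (distinct τ) → ∀ x →
  count (λ y → toℕ (lookup τ y) <ᵇ toℕ (lookup τ x)) (allFin m) ≡ toℕ (lookup τ x)
count-below-injective {m} τ τ-distinct x = begin
  count (λ y → toℕ (lookup τ y) <ᵇ K) (allFin m) ≡⟨ count-tabulate (λ y → toℕ (lookup τ y) <ᵇ K) (λ y → y) ⟩
  ∑[ y < m ] 𝟙 (toℕ (lookup τ y) <ᵇ K)           ≡⟨ ∑-permute τ τ-distinct (λ w → 𝟙 (toℕ w <ᵇ K)) ⟩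
  ∑[ w < m ] 𝟙 (toℕ w <ᵇ K)                      ≡⟨ ∑-𝟙-<ᵇ K (<⇒≤ (toℕ<n (lookup τ x))) ⟩
  K                                              ∎
  where
  open ≡-Reasoning
  K = toℕ (lookup τ x)

perms-with : ∀ n → (Vec (Fin n) n → Bool) → (Vec (Fin n) n → ℕ) → ℕ → ℕ
perms-with n P s t = count (λ σ → distinct σ ∧ (P σ ∧ (s σ ≡ᵇ t))) (vecs (allFin n) n)

count-perms-by-value : ∀ n K (P : Vec (Fin n) n → Bool) (s : Vec (Fin n) n → ℕ) →
  (∀ σ → T (distinct σ) → T (P σ) → s σ < K) →
  count (λ σ → distinct σ ∧ P σ) (vecs (allFin n) n) ≡ ∑[ t < K ] perms-with n P s (toℕ t)
count-perms-by-value n K P s bound =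
  trans (count-partition K (λ σ → distinct σ ∧ P σ) s bound′ (vecs (allFin n) n))
        (sum-cong-≗ {K} λ t → count-cong (λ σ → ∧-assoc (distinct σ) (P σ) _) (vecs (allFin n) n))
  where
  bound′ : ∀ σ → T (distinct σ ∧ P σ) → s σ < K
  bound′ σ h = let σ-distinct , Pσ = to (T-∧ {distinct σ}) h in bound σ σ-distinct Pσ

-- Deleting the head writes σ = v ∷ map (punchIn v) ρ; B v ρ says that v is an admissible head giving
-- statistic t, and the fibre hypothesis asks for exactly one such v, which exists iff R (s′ ρ).
perms-with-insertion : ∀ {m} K (P : Vec (Fin (suc m)) (suc m) → Bool) (s : Vec (Fin (suc m)) (suc m) → ℕ) t
  (Q : Vec (Fin m) m → Bool) (s′ : Vec (Fin m) m → ℕ) (B : Fin (suc m) → Vec (Fin m) m → Bool) (R : ℕ → Bool) →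
  (∀ v ρ → P (v ∷ map (punchIn v) ρ) ∧ (s (v ∷ map (punchIn v) ρ) ≡ᵇ t) ≡ Q ρ ∧ B v ρ) →
  (∀ ρ → T (distinct ρ) → T (Q ρ) → ∑[ v < suc m ] 𝟙 (B v ρ) ≡ 𝟙 (R (s′ ρ))) →
  (∀ ρ → T (distinct ρ) → T (Q ρ) → s′ ρ < K) →
  perms-with (suc m) P s t ≡ ∑[ t′ < K ] (𝟙 (R (toℕ t′)) * perms-with m Q s′ (toℕ t′))
perms-with-insertion {m} K P s t Q s′ B R split fibre bound = begin
  perms-with (suc m) P s t
    ≡⟨ count-distinct-by-head m (λ σ → P σ ∧ (s σ ≡ᵇ t)) ⟩
  ∑[ v < suc m ] count (λ ρ → distinct ρ ∧ (P (v ∷ map (punchIn v) ρ) ∧ (s (v ∷ map (punchIn v) ρ) ≡ᵇ t))) ρs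
    ≡⟨ sum-cong-≗ {suc m} (λ v → count-cong (λ ρ → trans (cong (distinct ρ ∧_) (split v ρ))
                                                         (sym (∧-assoc (distinct ρ) (Q ρ) (B v ρ)))) ρs) ⟩
  ∑[ v < suc m ] count (λ ρ → (distinct ρ ∧ Q ρ) ∧ B v ρ) ρs
    ≡⟨ ∑-count {n = suc m} (λ v ρ → (distinct ρ ∧ Q ρ) ∧ B v ρ) (λ ρ → (distinct ρ ∧ Q ρ) ∧ R (s′ ρ)) fibre′ ρs ⟩
  count (λ ρ → (distinct ρ ∧ Q ρ) ∧ R (s′ ρ)) ρs
    ≡⟨ count-by-value K (λ ρ → distinct ρ ∧ Q ρ) s′ R bound′ ρs ⟩
  ∑[ t′ < K ] (𝟙 (R (toℕ t′)) * count (λ ρ → (distinct ρ ∧ Q ρ) ∧ (s′ ρ ≡ᵇ toℕ t′)) ρs)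
    ≡⟨ sum-cong-≗ {K} (λ t′ → cong (𝟙 (R (toℕ t′)) *_) (count-cong (λ ρ → ∧-assoc (distinct ρ) (Q ρ) _) ρs)) ⟩
  ∑[ t′ < K ] (𝟙 (R (toℕ t′)) * perms-with m Q s′ (toℕ t′)) ∎
  where
  open ≡-Reasoning
  ρs = vecs (allFin m) m
  fibre′ : ∀ ρ → ∑[ v < suc m ] 𝟙 ((distinct ρ ∧ Q ρ) ∧ B v ρ) ≡ 𝟙 ((distinct ρ ∧ Q ρ) ∧ R (s′ ρ))
  fibre′ ρ = ∑-𝟙-∧ˡ (distinct ρ ∧ Q ρ) (λ v → B v ρ) (R (s′ ρ))
               (λ h → let ρ-distinct , Qρ = to (T-∧ {distinct ρ}) h in fibre ρ ρ-distinct Qρ)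
  bound′ : ∀ ρ → T (distinct ρ ∧ Q ρ) → s′ ρ < K
  bound′ ρ h = let ρ-distinct , Qρ = to (T-∧ {distinct ρ}) h in bound ρ ρ-distinct Qρ

count-≢ : ∀ {n} (c : Fin (suc n)) → count (λ x → neq x c) (allFin (suc n)) ≡ n
count-≢ {n} c = begin
  count (λ x → neq x c) (allFin (suc n))      ≡⟨ count-tabulate (λ x → neq x c) (λ x → x) ⟩
  ∑[ x < suc n ] 𝟙 (neq x c)                  ≡⟨ sum-remove {i = c} (λ x → 𝟙 (neq x c)) ⟩
  𝟙 (neq c c) + ∑[ i < n ] 𝟙 (neq (punchIn c i) c) ≡⟨ cong₂ _+_ (cong 𝟙 neq-c-c) (sum-cong-≗ {n} (cong 𝟙 ∘ neq-punchIn-c)) ⟩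
  0 + ∑[ i < n ] 1                             ≡⟨ ∑-const-1 n ⟩
  n                                            ∎
  where
  open ≡-Reasoning
  neq-c-c : neq c c ≡ false
  neq-c-c = T-⇔⇒≡ (mk⇔ (λ c≢c → contradiction refl (to T-neq c≢c)) (λ ()))
  neq-punchIn-c : ∀ i → neq (punchIn c i) c ≡ true
  neq-punchIn-c i = T-⇔⇒≡ (mk⇔ (λ _ → _) (λ _ → from T-neq (punchInᵢ≢i c i)))

-- The cyclic order of ℕ and chains

toℕ-punchIn-< : ∀ {m} (v : Fin (suc m)) (x : Fin m) → toℕ x < toℕ v → toℕ (punchIn v x) ≡ toℕ x
toℕ-punchIn-< (suc v) zero    _         = refl
toℕ-punchIn-< (suc v) (suc x) (s≤s x<v) = cong suc (toℕ-punchIn-< v x x<v)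

toℕ-punchIn-≥ : ∀ {m} (v : Fin (suc m)) (x : Fin m) → toℕ v ≤ toℕ x → toℕ (punchIn v x) ≡ suc (toℕ x)
toℕ-punchIn-≥ zero    x       _         = refl
toℕ-punchIn-≥ (suc v) (suc x) (s≤s v≤x) = cong suc (toℕ-punchIn-≥ v x v≤x)

punchIn-<-⇔ : ∀ {m} (v : Fin (suc m)) {x y : Fin m} → toℕ (punchIn v x) < toℕ (punchIn v y) ⇔ toℕ x < toℕ y
punchIn-<-⇔ v {x} {y} = mk⇔
  (λ px<py → ≰⇒> (λ y≤x → <⇒≱ px<py (punchIn-mono-≤ v y x y≤x)))
  (λ x<y → ≰⇒> (λ py≤px → <⇒≱ x<y (punchIn-cancel-≤ v y x py≤px)))

majority : Bool → Bool → Bool → Bool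
majority a b c = (a ∧ b) ∨ (b ∧ c) ∨ (c ∧ a)

T-majority : ∀ {a b c} → T (majority a b c) ⇔ ((T a × T b) ⊎ (T b × T c) ⊎ (T c × T a))
T-majority {a} {b} {c} = mk⇔
  (λ h → [ (λ ab → inj₁ (to (T-∧ {a}) ab))
          , (λ h′ → inj₂ ([ (λ bc → inj₁ (to (T-∧ {b}) bc)) , (λ ca → inj₂ (to (T-∧ {c}) ca)) ]′ (to (T-∨ {b ∧ c}) h′)))
          ]′ (to (T-∨ {a ∧ b}) h))
  (λ { (inj₁ ab) → from (T-∨ {a ∧ b}) (inj₁ (from (T-∧ {a}) ab))
     ; (inj₂ (inj₁ bc)) → from (T-∨ {a ∧ b}) (inj₂ (from (T-∨ {b ∧ c}) (inj₁ (from (T-∧ {b}) bc))))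
     ; (inj₂ (inj₂ ca)) → from (T-∨ {a ∧ b}) (inj₂ (from (T-∨ {b ∧ c}) (inj₂ (from (T-∧ {c}) ca)))) })

cyclicᵇ : ℕ → ℕ → ℕ → Bool
cyclicᵇ x y z = majority (x <ᵇ y) (y <ᵇ z) (z <ᵇ x)

T-cyclicᵇ : ∀ {x y z} → T (cyclicᵇ x y z) ⇔ Cyclic _<_ x y z
T-cyclicᵇ {x} {y} {z} = mk⇔
  (λ h → cyclic-mono {R = λ a b → T (a <ᵇ b)} (λ {a} {b} → <ᵇ⇒< a b) (to (T-majority {x <ᵇ y} {y <ᵇ z} {z <ᵇ x}) h))
  (λ c → from (T-majority {x <ᵇ y} {y <ᵇ z} {z <ᵇ x}) (cyclic-mono {R = _<_} {S = λ a b → T (a <ᵇ b)} <⇒<ᵇ c))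

cyclicᶠ : ∀ {N} → Fin N → Fin N → Fin N → Bool
cyclicᶠ x y z = cyclicᵇ (toℕ x) (toℕ y) (toℕ z)

cyclicᶠ-punchIn : ∀ {m} (v : Fin (suc m)) (x y z : Fin m) →
  cyclicᶠ (punchIn v x) (punchIn v y) (punchIn v z) ≡ cyclicᶠ x y z
cyclicᶠ-punchIn v x y z = T-⇔⇒≡ (mk⇔
  (λ h → from T-cyclicᵇ (cyclic-mono {R = _<ᵖ_} {S = _<ᶠ_} (to (punchIn-<-⇔ v)) (to T-cyclicᵇ h)))
  (λ h → from T-cyclicᵇ (cyclic-mono {R = _<ᶠ_} {S = _<ᵖ_} (from (punchIn-<-⇔ v)) (to T-cyclicᵇ h))))
  where
  _<ᶠ_ _<ᵖ_ : _ → _ → Set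
  a <ᶠ b = toℕ a < toℕ b
  a <ᵖ b = toℕ (punchIn v a) < toℕ (punchIn v b)

chain : ∀ {N L} → Vec (Fin N) L → Bool
chain (x ∷ y ∷ z ∷ r) = cyclicᶠ x y z ∧ chain (y ∷ z ∷ r)
chain _               = true

chain-punchIn : ∀ {m L} (v : Fin (suc m)) (ρ : Vec (Fin m) L) → chain (map (punchIn v) ρ) ≡ chain ρ
chain-punchIn v []              = refl
chain-punchIn v (x ∷ [])        = refl
chain-punchIn v (x ∷ y ∷ [])    = refl
chain-punchIn v (x ∷ y ∷ z ∷ r) = cong₂ _∧_ (cyclicᶠ-punchIn v x y z) (chain-punchIn v (y ∷ z ∷ r))

<-punchInᵢ-⇔ : ∀ {m} (v : Fin (suc m)) (w : Fin m) → toℕ v < toℕ (punchIn v w) ⇔ toℕ v ≤ toℕ w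
<-punchInᵢ-⇔ v w = mk⇔
  (λ v<pw → ≮⇒≥ (λ w<v → <-asym w<v (subst (toℕ v <_) (toℕ-punchIn-< v w w<v) v<pw)))
  (λ v≤w → subst (toℕ v <_) (sym (toℕ-punchIn-≥ v w v≤w)) (s≤s v≤w))

punchInᵢ-<-⇔ : ∀ {m} (v : Fin (suc m)) (w : Fin m) → toℕ (punchIn v w) < toℕ v ⇔ toℕ w < toℕ v
punchInᵢ-<-⇔ v w = mk⇔
  (λ pw<v → ≰⇒> (λ v≤w → <-asym pw<v (subst (toℕ v <_) (sym (toℕ-punchIn-≥ v w v≤w)) (s≤s v≤w))))
  (λ w<v → subst (_< toℕ v) (sym (toℕ-punchIn-< v w w<v)) w<v)

≢⇒<⊎> : ∀ {x y : ℕ} → x ≢ y → x < y ⊎ y < x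
≢⇒<⊎> {x} {y} x≢y with <-cmp x y
... | tri< x<y _ _ = inj₁ x<y
... | tri≈ _ x≡y _ = contradiction x≡y x≢y
... | tri> _ _ y<x = inj₂ y<x

module ℕ-Cyclic = StrictLinearOrder {_<_ = _<_} (<-irrefl refl) <-trans ≢⇒<⊎>

Chained : ∀ {N L} → Vec (Fin N) L → Set
Chained τ = ∀ x y z → toℕ y ≡ suc (toℕ x) → toℕ z ≡ suc (suc (toℕ x)) →
            T (cyclicᶠ (lookup τ x) (lookup τ y) (lookup τ z))

chain⇒Chained : ∀ {N L} (τ : Vec (Fin N) L) → T (chain τ) → Chained τ
chain⇒Chained (a ∷ b ∷ [])    _ _       _          (suc zero)       _    ()
chain⇒Chained (a ∷ b ∷ c ∷ r) h zero    (suc zero) (suc (suc zero)) refl refl = proj₁ (to (T-∧ {cyclicᶠ a b c}) h)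
chain⇒Chained (a ∷ b ∷ c ∷ r) h (suc x) (suc y)    (suc z)          y≡1+x z≡2+x =
  chain⇒Chained (b ∷ c ∷ r) (proj₂ (to (T-∧ {cyclicᶠ a b c}) h)) x y z (suc-injective y≡1+x) (suc-injective z≡2+x)

Chained⇒chain : ∀ {N L} (τ : Vec (Fin N) L) → Chained τ → T (chain τ)
Chained⇒chain []              _ = tt
Chained⇒chain (a ∷ [])        _ = tt
Chained⇒chain (a ∷ b ∷ [])    _ = tt
Chained⇒chain (a ∷ b ∷ c ∷ r) h = from (T-∧ {cyclicᶠ a b c})
  ( h zero (suc zero) (suc (suc zero)) refl refl
  , Chained⇒chain (b ∷ c ∷ r) (λ x y z y≡1+x z≡2+x → h (suc x) (suc y) (suc z) (cong suc y≡1+x) (cong suc z≡2+x)))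

-- Up/down permutations

stepᵇ : ∀ {N} → Bool → Fin N → Fin N → Bool
stepᵇ up x y = if up then ⌊ x <? y ⌋ else ⌊ y <? x ⌋

alternating : ∀ {N L} → Bool → Vec (Fin N) L → Bool
alternating up (x ∷ y ∷ r) = stepᵇ up x y ∧ alternating (not up) (y ∷ r)
alternating up _           = true

parity : Bool → ℕ → Bool
parity up zero    = up
parity up (suc p) = parity (not up) p

parity-true : ∀ p → parity true p ≡ even p
parity-true zero          = refl
parity-true (suc zero)    = refl
parity-true (suc (suc p)) = parity-true p

Alternates : ∀ {N L} → Bool → Vec (Fin N) L → Set
Alternates up σ = ∀ p q → toℕ q ≡ suc (toℕ p) → T (stepᵇ (parity up (toℕ p)) (lookup σ p) (lookup σ q))

alternating⇒Alternates : ∀ {N L} up (σ : Vec (Fin N) L) → T (alternating up σ) → Alternates up σ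
alternating⇒Alternates up (x ∷ y ∷ r) h zero    (suc zero) refl = proj₁ (to (T-∧ {stepᵇ up x y}) h)
alternating⇒Alternates up (x ∷ y ∷ r) h (suc p) (suc q)    e    =
  alternating⇒Alternates (not up) (y ∷ r) (proj₂ (to (T-∧ {stepᵇ up x y}) h)) p q (suc-injective e)

Alternates⇒alternating : ∀ {N L} up (σ : Vec (Fin N) L) → Alternates up σ → T (alternating up σ)
Alternates⇒alternating up []          _ = tt
Alternates⇒alternating up (x ∷ [])    _ = tt
Alternates⇒alternating up (x ∷ y ∷ r) h = from (T-∧ {stepᵇ up x y})
  (h zero (suc zero) refl , Alternates⇒alternating (not up) (y ∷ r) (λ p q e → h (suc p) (suc q) (cong suc e)))

isUpDown≡alternating : ∀ {n} (σ : Vec (Fin n) n) → isUpDown σ ≡ alternating true σ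
isUpDown≡alternating σ = T-⇔⇒≡ (mk⇔
  (λ h → Alternates⇒alternating true σ λ p q e →
     subst (λ up → T (stepᵇ up (lookup σ p) (lookup σ q))) (sym (parity-true (toℕ p)))
       (to (T-⇒ᵇ {⌊ toℕ q ≟ℕ suc (toℕ p) ⌋}) (to T-∀ᶠ (to T-∀ᶠ h p) q) (fromWitness e)))
  (λ h → from T-∀ᶠ λ p → from T-∀ᶠ λ q → from (T-⇒ᵇ {⌊ toℕ q ≟ℕ suc (toℕ p) ⌋}) λ e →
     subst (λ up → T (stepᵇ up (lookup σ p) (lookup σ q))) (parity-true (toℕ p))
       (alternating⇒Alternates true σ h p q (toWitness e))))

room : Bool → ∀ {N L} → Vec (Fin N) L → ℕ
room _     []              = 0
room true  {N} (x ∷ _)     = N ∸ suc (toℕ x)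
room false     (x ∷ _)     = toℕ x

T-<? : ∀ {N} {x y : Fin N} → T ⌊ x <? y ⌋ ⇔ toℕ x < toℕ y
T-<? = mk⇔ toWitness fromWitness

<?-punchIn : ∀ {m} (v : Fin (suc m)) (x y : Fin m) → ⌊ punchIn v x <? punchIn v y ⌋ ≡ ⌊ x <? y ⌋
<?-punchIn v x y = T-⇔⇒≡ (mk⇔ (from T-<? ∘ to (punchIn-<-⇔ v) ∘ to T-<?) (from T-<? ∘ from (punchIn-<-⇔ v) ∘ to T-<?))

stepᵇ-punchIn : ∀ {m} (v : Fin (suc m)) up (x y : Fin m) → stepᵇ up (punchIn v x) (punchIn v y) ≡ stepᵇ up x y
stepᵇ-punchIn v true  x y = <?-punchIn v x y
stepᵇ-punchIn v false x y = <?-punchIn v y x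

alternating-punchIn : ∀ {m L} (v : Fin (suc m)) up (ρ : Vec (Fin m) L) → alternating up (map (punchIn v) ρ) ≡ alternating up ρ
alternating-punchIn v up []          = refl
alternating-punchIn v up (x ∷ [])    = refl
alternating-punchIn v up (x ∷ y ∷ r) = cong₂ _∧_ (stepᵇ-punchIn v up x y) (alternating-punchIn v (not up) (y ∷ r))

∸≤-⇔-≤+ : ∀ K t w → K ∸ t ≤ w ⇔ K ≤ t + w
∸≤-⇔-≤+ K t w = mk⇔ (λ h → ≤-trans (m≤n+m∸n K t) (+-monoʳ-≤ t h)) (m≤n+o⇒m∸n≤o K t)

≤+∸-⇔-≤ : ∀ {K a} t → a ≤ K → K ≤ t + (K ∸ a) ⇔ a ≤ t
≤+∸-⇔-≤ {K} {a} t a≤K = mk⇔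
  (λ h → +-cancelʳ-≤ (K ∸ a) a t (subst (_≤ t + (K ∸ a)) (sym (m+[n∸m]≡n a≤K)) h))
  (λ a≤t → subst (_≤ t + (K ∸ a)) (m+[n∸m]≡n a≤K) (+-monoˡ-≤ (K ∸ a) a≤t))

alternating-perms : Bool → ℕ → ℕ → ℕ
alternating-perms up n = perms-with n (alternating up) (room up)

fitsAsHead : Bool → ℕ → ∀ {k} → Fin (suc (suc k)) → Vec (Fin (suc k)) (suc k) → Bool
fitsAsHead up t v (w ∷ r) = stepᵇ up v (punchIn v w) ∧ (room up (v ∷ map (punchIn v) (w ∷ r)) ≡ᵇ t)

∑-fitsAsHead-ascent : ∀ {k} t → t < suc (suc k) → (ρ : Vec (Fin (suc k)) (suc k)) →
  ∑[ v < suc (suc k) ] 𝟙 (fitsAsHead true t v ρ) ≡ 𝟙 (suc k ≤ᵇ t + room false ρ)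
∑-fitsAsHead-ascent {k} t t<k+2 (w ∷ r) = trans (∑-𝟙-unique _ v₀ only-v₀) (cong 𝟙 (T-⇔⇒≡ (mk⇔ fits⇒ ⇒fits)))
  where
  t≤k+1 = ≤-pred t<k+2
  v₀ : Fin (suc (suc k))
  v₀ = fromℕ< (s≤s (m∸n≤m (suc k) t))
  toℕ-v₀ : toℕ v₀ ≡ suc k ∸ t
  toℕ-v₀ = toℕ-fromℕ< (s≤s (m∸n≤m (suc k) t))
  only-v₀ : ∀ v → T (fitsAsHead true t v (w ∷ r)) → v ≡ v₀
  only-v₀ v h = toℕ-injective (begin
    toℕ v                   ≡⟨ m∸[m∸n]≡n (toℕ≤pred[n] v) ⟨
    suc k ∸ (suc k ∸ toℕ v) ≡⟨ cong (suc k ∸_) (to (T-≡ᵇ (suc k ∸ toℕ v) t) (proj₂ (to (T-∧ {stepᵇ true v (punchIn v w)}) h))) ⟩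
    suc k ∸ t               ≡⟨ toℕ-v₀ ⟨
    toℕ v₀                  ∎)
    where open ≡-Reasoning
  fits⇒ : T (fitsAsHead true t v₀ (w ∷ r)) → T (suc k ≤ᵇ t + toℕ w)
  fits⇒ h = from (T-≤ᵇ _ _) (to (∸≤-⇔-≤+ (suc k) t (toℕ w))
    (subst (_≤ toℕ w) toℕ-v₀ (to (<-punchInᵢ-⇔ v₀ w) (to T-<? (proj₁ (to (T-∧ {stepᵇ true v₀ (punchIn v₀ w)}) h))))))
  ⇒fits : T (suc k ≤ᵇ t + toℕ w) → T (fitsAsHead true t v₀ (w ∷ r))
  ⇒fits h = from (T-∧ {stepᵇ true v₀ (punchIn v₀ w)})
    ( from T-<? (from (<-punchInᵢ-⇔ v₀ w) (subst (_≤ toℕ w) (sym toℕ-v₀) (from (∸≤-⇔-≤+ (suc k) t (toℕ w)) (to (T-≤ᵇ _ _) h))))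
    , from (T-≡ᵇ _ t) (trans (cong (suc k ∸_) toℕ-v₀) (m∸[m∸n]≡n t≤k+1)))
∑-fitsAsHead-descent : ∀ {k} t → t < suc (suc k) → (ρ : Vec (Fin (suc k)) (suc k)) →
  ∑[ v < suc (suc k) ] 𝟙 (fitsAsHead false t v ρ) ≡ 𝟙 (suc k ≤ᵇ t + room true ρ)
∑-fitsAsHead-descent {k} t t<k+2 (w ∷ r) = trans (∑-𝟙-unique _ v₀ only-v₀) (cong 𝟙 (T-⇔⇒≡ (mk⇔ fits⇒ ⇒fits)))
  where
  v₀ : Fin (suc (suc k))
  v₀ = fromℕ< t<k+2
  toℕ-v₀ : toℕ v₀ ≡ t
  toℕ-v₀ = toℕ-fromℕ< t<k+2
  only-v₀ : ∀ v → T (fitsAsHead false t v (w ∷ r)) → v ≡ v₀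
  only-v₀ v h = toℕ-injective (trans (to (T-≡ᵇ _ t) (proj₂ (to (T-∧ {stepᵇ false v (punchIn v w)}) h))) (sym toℕ-v₀))
  w<t⇔ : toℕ w < t ⇔ suc k ≤ t + (suc k ∸ suc (toℕ w))
  w<t⇔ = ⇔-sym (≤+∸-⇔-≤ t (s≤s (toℕ≤pred[n] w)))
  fits⇒ : T (fitsAsHead false t v₀ (w ∷ r)) → T (suc k ≤ᵇ t + (k ∸ toℕ w))
  fits⇒ h = from (T-≤ᵇ _ _) (to w<t⇔
    (subst (toℕ w <_) toℕ-v₀ (to (punchInᵢ-<-⇔ v₀ w) (to T-<? (proj₁ (to (T-∧ {stepᵇ false v₀ (punchIn v₀ w)}) h))))))
  ⇒fits : T (suc k ≤ᵇ t + (k ∸ toℕ w)) → T (fitsAsHead false t v₀ (w ∷ r))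
  ⇒fits h = from (T-∧ {stepᵇ false v₀ (punchIn v₀ w)})
    ( from T-<? (from (punchInᵢ-<-⇔ v₀ w) (subst (toℕ w <_) (sym toℕ-v₀) (from w<t⇔ (to (T-≤ᵇ _ _) h))))
    , from (T-≡ᵇ _ t) toℕ-v₀)

∑-fitsAsHead : ∀ up {k} t → t < suc (suc k) → (ρ : Vec (Fin (suc k)) (suc k)) →
  ∑[ v < suc (suc k) ] 𝟙 (fitsAsHead up t v ρ) ≡ 𝟙 (suc k ≤ᵇ t + room (not up) ρ)
∑-fitsAsHead true  = ∑-fitsAsHead-ascent
∑-fitsAsHead false = ∑-fitsAsHead-descent

room-bound : ∀ up {k} (ρ : Vec (Fin (suc k)) (suc k)) → room up ρ < suc k
room-bound true  {k} (w ∷ _) = s≤s (m∸n≤m k (toℕ w))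
room-bound false     (w ∷ _) = toℕ<n w

alternating-perms-insertion : ∀ up k t → t < suc (suc k) →
  alternating-perms up (suc (suc k)) t ≡
  ∑[ t′ < suc k ] (𝟙 (suc k ≤ᵇ t + toℕ t′) * alternating-perms (not up) (suc k) (toℕ t′))
alternating-perms-insertion up k t t<k+2 =
  perms-with-insertion (suc k) (alternating up) (room up) t (alternating (not up)) (room (not up))
    (fitsAsHead up t) (λ t′ → suc k ≤ᵇ t + t′) split
    (λ ρ _ _ → ∑-fitsAsHead up t t<k+2 ρ) (λ ρ _ _ → room-bound (not up) ρ)
  where
  split : ∀ v ρ → alternating up (v ∷ map (punchIn v) ρ) ∧ (room up (v ∷ map (punchIn v) ρ) ≡ᵇ t)
                  ≡ alternating (not up) ρ ∧ fitsAsHead up t v ρ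
  split v (w ∷ r) = trans (cong (λ a → (step ∧ a) ∧ room≡t) (alternating-punchIn v (not up) (w ∷ r)))
                          (trans (cong (_∧ room≡t) (∧-comm step (alternating (not up) (w ∷ r))))
                                 (∧-assoc (alternating (not up) (w ∷ r)) step room≡t))
    where
    step = stepᵇ up v (punchIn v w)
    room≡t = room up (v ∷ map (punchIn v) (w ∷ r)) ≡ᵇ t

-- Cyclic chains ending with their maximum

-- the number of elements strictly between x and y when going up from x in ℤ/N
gap : ℕ → ℕ → ℕ → ℕ
gap N x y = if x <ᵇ y then y ∸ suc x else N + y ∸ suc x

gap-< : ∀ N {x y} → x < y → gap N x y + suc x ≡ y
gap-< N {x} {y} x<y with x <ᵇ y | <⇒<ᵇ x<y
... | true | _ = m∸n+n≡m x<y

gap-≥ : ∀ N {x y} → y ≤ x → x < N → gap N x y + suc x ≡ N + y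
gap-≥ N {x} {y} y≤x x<N with x <ᵇ y in eq
... | true  = contradiction (<ᵇ⇒< x y (subst T (sym eq) tt)) (≤⇒≯ y≤x)
... | false = m∸n+n≡m (≤-trans x<N (m≤m+n N y))

arc : ∀ {N L} → Vec (Fin N) L → ℕ
arc {N} (x ∷ y ∷ _) = gap N (toℕ y) (toℕ x)
arc     _           = 0

endsWithMax : ∀ {n} → Vec (Fin (suc n)) (suc n) → Bool
endsWithMax {n} σ = toℕ (lookup σ (fromℕ n)) ≡ᵇ n

isCyclicChain : ∀ {n} → Vec (Fin (suc n)) (suc n) → Bool
isCyclicChain σ = endsWithMax σ ∧ chain σ

cyclic-perms : ℕ → ℕ → ℕ
cyclic-perms n = perms-with (suc n) isCyclicChain arc

toℕ-punchIn≡max-⇔ : ∀ {n} (v : Fin (suc (suc n))) (x : Fin (suc n)) →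
  toℕ (punchIn v x) ≡ suc n ⇔ (toℕ x ≡ n × toℕ v ≤ n)
toℕ-punchIn≡max-⇔ {n} v x = mk⇔ ⇒ ⇐
  where
  ⇒ : toℕ (punchIn v x) ≡ suc n → toℕ x ≡ n × toℕ v ≤ n
  ⇒ px≡1+n with toℕ x ℕ.<? toℕ v
  ... | yes x<v = contradiction (trans (sym (toℕ-punchIn-< v x x<v)) px≡1+n) (ℕ.<⇒≢ (s≤s (toℕ≤pred[n] x)))
  ... | no x≮v = x≡n , subst (toℕ v ≤_) x≡n (≮⇒≥ x≮v)
    where x≡n = suc-injective (trans (sym (toℕ-punchIn-≥ v x (≮⇒≥ x≮v))) px≡1+n)
  ⇐ : toℕ x ≡ n × toℕ v ≤ n → toℕ (punchIn v x) ≡ suc n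
  ⇐ (x≡n , v≤n) = trans (toℕ-punchIn-≥ v x (subst (toℕ v ≤_) (sym x≡n) v≤n)) (cong suc x≡n)

endsWithMax-punchIn : ∀ {n} (v : Fin (suc (suc n))) (ρ : Vec (Fin (suc n)) (suc n)) →
  endsWithMax (v ∷ map (punchIn v) ρ) ≡ endsWithMax ρ ∧ (toℕ v ≤ᵇ n)
endsWithMax-punchIn {n} v ρ = T-⇔⇒≡ (mk⇔
  (λ h → let x≡n , v≤n = to (toℕ-punchIn≡max-⇔ v x)
                              (subst (_≡ suc n) (cong toℕ (lookup-map (fromℕ n) (punchIn v) ρ)) (to (T-≡ᵇ _ _) h))
         in from (T-∧ {endsWithMax ρ}) (from (T-≡ᵇ _ _) x≡n , from (T-≤ᵇ _ _) v≤n))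
  (λ h → let x≡n , v≤n = to (T-∧ {endsWithMax ρ}) h
         in from (T-≡ᵇ _ _) (subst (_≡ suc n) (sym (cong toℕ (lookup-map (fromℕ n) (punchIn v) ρ)))
                               (from (toℕ-punchIn≡max-⇔ v x) (to (T-≡ᵇ _ _) x≡n , to (T-≤ᵇ _ _) v≤n)))))
  where
  x = lookup ρ (fromℕ n)

both : ∀ {P Q : Set} → P → Q → P ⇔ Q
both p q = mk⇔ (λ _ → q) (λ _ → p)

neither : ∀ {P Q : Set} → ¬ P → ¬ Q → P ⇔ Q
neither ¬p ¬q = mk⇔ (λ p → contradiction p ¬p) (λ q → contradiction q ¬q)

fitsInArc : ℕ → ∀ {k} → Fin (3 + k) → Vec (Fin (2 + k)) (2 + k) → Bool
fitsInArc t {k} v (a ∷ b ∷ r) =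
  ((toℕ v ≤ᵇ suc k) ∧ cyclicᶠ v (punchIn v a) (punchIn v b)) ∧ (arc (v ∷ map (punchIn v) (a ∷ b ∷ r)) ≡ᵇ t)

-- A new first entry v is inserted into the cycle of ρ = a ∷ b ∷ r; it may not become the maximum
-- (the last entry must stay maximal), so v ≤ k + 1. The arc statistic t determines v = a + 1 + t,
-- read cyclically: Above handles the case without wrap-around, Wrapped the case v = t + a − (k + 1).
module ArcInsertion {k : ℕ} (a b : Fin (suc (suc k))) (a≢b : toℕ a ≢ toℕ b) (t : ℕ) (t≤1+k : t ≤ suc k) where

  A B : ℕ
  A = toℕ a
  B = toℕ b

  Fits : Fin (3 + k) → Set
  Fits v = toℕ v ≤ suc k × Cyclic _<_ (toℕ v) (toℕ (punchIn v a)) (toℕ (punchIn v b))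
                         × gap (3 + k) (toℕ (punchIn v a)) (toℕ v) ≡ t

  Wanted : Set
  Wanted = suc k ≤ t + gap (2 + k) B A

  wanted-A<B : A < B → Wanted ⇔ B ≤ t + A
  wanted-A<B A<B = mk⇔
    (λ h → +-cancelʳ-≤ (2 + k) B (t + A) (subst₂ _≤_ e₁ e₂ (+-monoˡ-≤ (suc B) h)))
    (λ h → +-cancelʳ-≤ (suc B) (suc k) (t + g) (subst₂ _≤_ (sym e₁) (sym e₂) (+-monoˡ-≤ (2 + k) h)))
    where
    g = gap (2 + k) B A
    e₁ : suc k + suc B ≡ B + (2 + k)
    e₁ = shift k B
      where
      shift : ∀ x y → suc x + suc y ≡ y + (2 + x)
      shift = solve-∀
    e₂ : t + g + suc B ≡ t + A + (2 + k)
    e₂ = begin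
      t + g + suc B    ≡⟨ +-assoc t g (suc B) ⟩
      t + (g + suc B)  ≡⟨ cong (t +_) (gap-≥ (2 + k) (<⇒≤ A<B) (toℕ<n b)) ⟩
      t + (2 + k + A)  ≡⟨ regroup t k A ⟩
      t + A + (2 + k)  ∎
      where
      open ≡-Reasoning
      regroup : ∀ x y z → x + (2 + y + z) ≡ x + z + (2 + y)
      regroup = solve-∀

  wanted-B<A : B < A → Wanted ⇔ suc k + suc B ≤ t + A
  wanted-B<A B<A = mk⇔
    (λ h → subst (suc k + suc B ≤_) e (+-monoˡ-≤ (suc B) h))
    (λ h → +-cancelʳ-≤ (suc B) (suc k) (t + g) (subst (suc k + suc B ≤_) (sym e) h))
    where
    g = gap (2 + k) B A
    e : t + g + suc B ≡ t + A
    e = trans (+-assoc t g (suc B)) (cong (t +_) (gap-< (2 + k) B<A))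

  fits⇔cyclic : ∀ v → toℕ v ≤ suc k → gap (3 + k) (toℕ (punchIn v a)) (toℕ v) ≡ t →
    Fits v ⇔ Cyclic _<_ (toℕ v) (toℕ (punchIn v a)) (toℕ (punchIn v b))
  fits⇔cyclic v v≤1+k gap≡t = mk⇔ (λ (_ , c , _) → c) (λ c → v≤1+k , c , gap≡t)

  fits-position : ∀ v → Fits v → (A < toℕ v × toℕ v ≡ suc (t + A)) ⊎ (toℕ v ≤ A × suc k + toℕ v ≡ t + A)
  fits-position v (_ , _ , gap≡t) with A ℕ.<? toℕ v
  ... | yes A<v = inj₁ (A<v , (begin
    toℕ v                      ≡⟨ gap-< (3 + k) A<v ⟨
    gap (3 + k) A (toℕ v) + suc A ≡⟨ cong (λ x → gap (3 + k) x (toℕ v) + suc A) (toℕ-punchIn-< v a A<v) ⟨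
    gap (3 + k) (toℕ (punchIn v a)) (toℕ v) + suc A ≡⟨ cong (_+ suc A) gap≡t ⟩
    t + suc A                  ≡⟨ +-suc t A ⟩
    suc (t + A)                ∎))
    where open ≡-Reasoning
  ... | no A≮v = inj₂ (v≤A , suc-injective (suc-injective (begin
    3 + k + toℕ v                                        ≡⟨ gap-≥ (3 + k) (m≤n⇒m≤1+n v≤A) (s≤s (toℕ<n a)) ⟨
    gap (3 + k) (suc A) (toℕ v) + suc (suc A)            ≡⟨ cong (λ x → gap (3 + k) x (toℕ v) + suc (suc A)) (toℕ-punchIn-≥ v a v≤A) ⟨
    gap (3 + k) (toℕ (punchIn v a)) (toℕ v) + suc (suc A) ≡⟨ cong (_+ suc (suc A)) gap≡t ⟩
    t + suc (suc A)                                      ≡⟨ trans (+-suc t (suc A)) (cong suc (+-suc t A)) ⟩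
    suc (suc (t + A))                                    ∎)))
    where
    open ≡-Reasoning
    v≤A = ≮⇒≥ A≮v

  module Above (t+A<1+k : t + A < suc k) where

    1+t+A<3+k : suc (t + A) < 3 + k
    1+t+A<3+k = s≤s (s≤s (<⇒≤ t+A<1+k))

    v₀ : Fin (3 + k)
    v₀ = fromℕ< 1+t+A<3+k

    toℕ-v₀ : toℕ v₀ ≡ suc (t + A)
    toℕ-v₀ = toℕ-fromℕ< 1+t+A<3+k

    A<1+t+A : A < suc (t + A)
    A<1+t+A = s≤s (m≤n+m A t)

    only-v₀ : ∀ v → Fits v → v ≡ v₀
    only-v₀ v fits with fits-position v fits
    ... | inj₁ (_ , v≡1+t+A) = toℕ-injective (trans v≡1+t+A (sym toℕ-v₀))
    ... | inj₂ (_ , 1+k+v≡t+A) = contradiction (≤-trans (m≤m+n (suc k) (toℕ v)) (≤-reflexive 1+k+v≡t+A)) (<⇒≱ t+A<1+k)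

    cyclic⇔wanted : Cyclic _<_ (suc (t + A)) A (toℕ (punchIn v₀ b)) ⇔ Wanted
    cyclic⇔wanted with <-cmp B A
    ... | tri≈ _ B≡A _ = contradiction (sym B≡A) a≢b
    ... | tri< B<A _ _ rewrite toℕ-punchIn-< v₀ b (subst (B <_) (sym toℕ-v₀) (<-trans B<A A<1+t+A)) = neither
      (ℕ-Cyclic.cyclic-asym (inj₁ (B<A , A<1+t+A)))
      (λ w → <⇒≱ t+A<1+k (≤-trans (m≤m+n (suc k) (suc B)) (to (wanted-B<A B<A) w)))
    ... | tri> _ _ A<B with B ℕ.≤? t + A
    ...   | yes B≤t+A rewrite toℕ-punchIn-< v₀ b (subst (B <_) (sym toℕ-v₀) (s≤s B≤t+A)) =
      both (inj₂ (inj₁ (A<B , s≤s B≤t+A))) (from (wanted-A<B A<B) B≤t+A)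
    ...   | no B≰t+A rewrite toℕ-punchIn-≥ v₀ b (subst (_≤ B) (sym toℕ-v₀) (≰⇒> B≰t+A)) = neither
      (ℕ-Cyclic.cyclic-asym (inj₂ (inj₁ (A<1+t+A , s≤s (≰⇒> B≰t+A)))))
      (B≰t+A ∘ to (wanted-A<B A<B))

    fits-v₀ : Fits v₀ ⇔ Wanted
    fits-v₀ = ⇔-trans (fits⇔cyclic v₀ v₀≤1+k gap≡t)
                      (subst₂ (λ x y → Cyclic _<_ x y (toℕ (punchIn v₀ b)) ⇔ Wanted) (sym toℕ-v₀) (sym pa≡A) cyclic⇔wanted)
      where
      pa≡A : toℕ (punchIn v₀ a) ≡ A
      pa≡A = toℕ-punchIn-< v₀ a (subst (A <_) (sym toℕ-v₀) A<1+t+A)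
      v₀≤1+k : toℕ v₀ ≤ suc k
      v₀≤1+k = subst (_≤ suc k) (sym toℕ-v₀) t+A<1+k
      gap≡t : gap (3 + k) (toℕ (punchIn v₀ a)) (toℕ v₀) ≡ t
      gap≡t = +-cancelʳ-≡ (suc A) _ t (begin
        gap (3 + k) (toℕ (punchIn v₀ a)) (toℕ v₀) + suc A ≡⟨ cong₂ (λ x y → gap (3 + k) x y + suc A) pa≡A toℕ-v₀ ⟩
        gap (3 + k) A (suc (t + A)) + suc A              ≡⟨ gap-< (3 + k) A<1+t+A ⟩
        suc (t + A)                                      ≡⟨ +-suc t A ⟨
        t + suc A                                        ∎)
        where open ≡-Reasoning

  module Wrapped (1+k≤t+A : suc k ≤ t + A) where

    V₀ : ℕ
    V₀ = t + A ∸ suc k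

    V₀≤A : V₀ ≤ A
    V₀≤A = subst (V₀ ≤_) (m+n∸m≡n (suc k) A) (∸-monoˡ-≤ (suc k) (+-monoˡ-≤ A t≤1+k))

    1+k+V₀≡t+A : suc k + V₀ ≡ t + A
    1+k+V₀≡t+A = m+[n∸m]≡n 1+k≤t+A

    V₀<3+k : V₀ < 3 + k
    V₀<3+k = s≤s (≤-trans V₀≤A (≤-trans (toℕ≤pred[n] a) (n≤1+n _)))

    v₀ : Fin (3 + k)
    v₀ = fromℕ< V₀<3+k

    toℕ-v₀ : toℕ v₀ ≡ V₀
    toℕ-v₀ = toℕ-fromℕ< V₀<3+k

    only-v₀ : ∀ v → Fits v → v ≡ v₀
    only-v₀ v fits with fits-position v fits
    ... | inj₁ (_ , v≡1+t+A) = contradiction (≤-trans (proj₁ fits) 1+k≤t+A) (<⇒≱ (subst (t + A <_) (sym v≡1+t+A) ≤-refl))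
    ... | inj₂ (_ , 1+k+v≡t+A) = toℕ-injective (begin
      toℕ v                   ≡⟨ m+n∸m≡n (suc k) (toℕ v) ⟨
      suc k + toℕ v ∸ suc k   ≡⟨ cong (_∸ suc k) 1+k+v≡t+A ⟩
      V₀                      ≡⟨ toℕ-v₀ ⟨
      toℕ v₀                  ∎)
      where open ≡-Reasoning

    cyclic⇔wanted : Cyclic _<_ V₀ (suc A) (toℕ (punchIn v₀ b)) ⇔ Wanted
    cyclic⇔wanted with <-cmp B A
    ... | tri≈ _ B≡A _ = contradiction (sym B≡A) a≢b
    ... | tri> _ _ A<B rewrite toℕ-punchIn-≥ v₀ b (subst (_≤ B) (sym toℕ-v₀) (≤-trans V₀≤A (<⇒≤ A<B))) =
      both (inj₁ (s≤s V₀≤A , s≤s A<B)) (from (wanted-A<B A<B) (≤-trans (toℕ≤pred[n] b) 1+k≤t+A))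
    ... | tri< B<A _ _ with B ℕ.<? V₀
    ...   | yes B<V₀ rewrite toℕ-punchIn-< v₀ b (subst (B <_) (sym toℕ-v₀) B<V₀) =
      both (inj₂ (inj₂ (B<V₀ , s≤s V₀≤A))) (from (wanted-B<A B<A) (subst (suc k + suc B ≤_) 1+k+V₀≡t+A (+-monoʳ-≤ (suc k) B<V₀)))
    ...   | no B≮V₀ rewrite toℕ-punchIn-≥ v₀ b (subst (_≤ B) (sym toℕ-v₀) (≮⇒≥ B≮V₀)) = neither
      (ℕ-Cyclic.cyclic-asym (inj₂ (inj₂ (s≤s (≮⇒≥ B≮V₀) , s≤s B<A))))
      (λ w → B≮V₀ (+-cancelˡ-≤ (suc k) (suc B) V₀ (subst (suc k + suc B ≤_) (sym 1+k+V₀≡t+A) (to (wanted-B<A B<A) w))))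

    fits-v₀ : Fits v₀ ⇔ Wanted
    fits-v₀ = ⇔-trans (fits⇔cyclic v₀ v₀≤1+k gap≡t)
                      (subst₂ (λ x y → Cyclic _<_ x y (toℕ (punchIn v₀ b)) ⇔ Wanted) (sym toℕ-v₀) (sym pa≡1+A) cyclic⇔wanted)
      where
      pa≡1+A : toℕ (punchIn v₀ a) ≡ suc A
      pa≡1+A = toℕ-punchIn-≥ v₀ a (subst (_≤ A) (sym toℕ-v₀) V₀≤A)
      v₀≤1+k : toℕ v₀ ≤ suc k
      v₀≤1+k = subst (_≤ suc k) (sym toℕ-v₀) (≤-trans V₀≤A (toℕ≤pred[n] a))
      gap≡t : gap (3 + k) (toℕ (punchIn v₀ a)) (toℕ v₀) ≡ t
      gap≡t = +-cancelʳ-≡ (suc (suc A)) _ t (begin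
        gap (3 + k) (toℕ (punchIn v₀ a)) (toℕ v₀) + suc (suc A) ≡⟨ cong₂ (λ x y → gap (3 + k) x y + suc (suc A)) pa≡1+A toℕ-v₀ ⟩
        gap (3 + k) (suc A) V₀ + suc (suc A)                   ≡⟨ gap-≥ (3 + k) (m≤n⇒m≤1+n V₀≤A) (s≤s (toℕ<n a)) ⟩
        suc (suc (suc k + V₀))                                 ≡⟨ cong (λ x → suc (suc x)) 1+k+V₀≡t+A ⟩
        suc (suc (t + A))                                      ≡⟨ trans (+-suc t (suc A)) (cong suc (+-suc t A)) ⟨
        t + suc (suc A)                                        ∎)
        where open ≡-Reasoning

  T-fitsInArc : ∀ v r → T (fitsInArc t v (a ∷ b ∷ r)) ⇔ Fits v
  T-fitsInArc v r = mk⇔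
    (λ h → let h₁₂ , h₃ = to (T-∧ {(toℕ v ≤ᵇ suc k) ∧ cyclicᶠ v (punchIn v a) (punchIn v b)}) h
               h₁ , h₂ = to (T-∧ {toℕ v ≤ᵇ suc k}) h₁₂
           in to (T-≤ᵇ _ _) h₁ , to T-cyclicᵇ h₂ , to (T-≡ᵇ _ t) h₃)
    (λ (v≤1+k , c , gap≡t) → from (T-∧ {(toℕ v ≤ᵇ suc k) ∧ cyclicᶠ v (punchIn v a) (punchIn v b)})
        (from (T-∧ {toℕ v ≤ᵇ suc k}) (from (T-≤ᵇ _ _) v≤1+k , from T-cyclicᵇ c) , from (T-≡ᵇ _ t) gap≡t))

  ∑-unique-fit : ∀ r v₀ → (∀ v → Fits v → v ≡ v₀) → (Fits v₀ ⇔ Wanted) →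
    ∑[ v < 3 + k ] 𝟙 (fitsInArc t v (a ∷ b ∷ r)) ≡ 𝟙 (suc k ≤ᵇ t + gap (2 + k) B A)
  ∑-unique-fit r v₀ only-v₀ fits-v₀ = trans
    (∑-𝟙-unique (λ v → fitsInArc t v (a ∷ b ∷ r)) v₀ (λ v h → only-v₀ v (to (T-fitsInArc v r) h)))
    (cong 𝟙 (T-⇔⇒≡ (⇔-trans (T-fitsInArc v₀ r) (⇔-trans fits-v₀ (⇔-sym (T-≤ᵇ _ _))))))

  ∑-fitsInArc : ∀ r → ∑[ v < 3 + k ] 𝟙 (fitsInArc t v (a ∷ b ∷ r)) ≡ 𝟙 (suc k ≤ᵇ t + gap (2 + k) B A)
  ∑-fitsInArc r with t + A ℕ.<? suc k
  ... | yes t+A<1+k = ∑-unique-fit r v₀ only-v₀ fits-v₀ where open Above t+A<1+k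
  ... | no  t+A≮1+k = ∑-unique-fit r v₀ only-v₀ fits-v₀ where open Wrapped (≮⇒≥ t+A≮1+k)

gap-bound : ∀ {n x y} → x ≢ y → x ≤ n → y ≤ n → gap (suc n) x y < n
gap-bound {n} {x} {y} x≢y x≤n y≤n with ≢⇒<⊎> x≢y
... | inj₁ x<y = ≤-trans (subst (suc g ≤_) e (s≤s (m≤n+m g x))) y≤n
  where
  g = gap (suc n) x y
  e : suc (x + g) ≡ y
  e = trans (cong suc (+-comm x g)) (trans (sym (+-suc g x)) (gap-< (suc n) x<y))
... | inj₂ y<x = +-cancelʳ-< x g n (subst (_< n + x) (sym e) (+-monoʳ-< n y<x))
  where
  g = gap (suc n) x y
  e : g + x ≡ n + y
  e = suc-injective (trans (sym (+-suc g x)) (gap-≥ (suc n) (<⇒≤ y<x) (s≤s x≤n)))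

distinct⇒head≢ : ∀ {N L} {a b : Fin N} {r : Vec (Fin N) L} → T (distinct (a ∷ b ∷ r)) → toℕ a ≢ toℕ b
distinct⇒head≢ {a = a} {b} {r} h =
  to T-neq (proj₁ (to (T-∧ {neq a b}) (proj₁ (to (T-∧ {fresh a (b ∷ r)}) h)))) ∘ toℕ-injective

arc-bound : ∀ {k} (ρ : Vec (Fin (2 + k)) (2 + k)) → T (distinct ρ) → arc ρ < suc k
arc-bound (a ∷ b ∷ r) h = gap-bound (λ B≡A → distinct⇒head≢ {r = r} h (sym B≡A)) (toℕ≤pred[n] b) (toℕ≤pred[n] a)


cyclic-perms-insertion : ∀ k t → t < 2 + k →
  cyclic-perms (2 + k) t ≡ ∑[ t′ < suc k ] (𝟙 (suc k ≤ᵇ t + toℕ t′) * cyclic-perms (suc k) (toℕ t′))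
cyclic-perms-insertion k t t<2+k =
  perms-with-insertion (suc k) isCyclicChain arc t isCyclicChain arc
    (fitsInArc t) (λ t′ → suc k ≤ᵇ t + t′) split
    (λ { (a ∷ b ∷ r) ρ-distinct _ → ArcInsertion.∑-fitsInArc a b (distinct⇒head≢ {r = r} ρ-distinct) t (≤-pred t<2+k) r })
    (λ ρ ρ-distinct _ → arc-bound ρ ρ-distinct)
  where
  split : ∀ v ρ → (endsWithMax (v ∷ map (punchIn v) ρ) ∧ chain (v ∷ map (punchIn v) ρ)) ∧ (arc (v ∷ map (punchIn v) ρ) ≡ᵇ t)
                  ≡ isCyclicChain ρ ∧ fitsInArc t v ρ
  split v ρ@(a ∷ b ∷ r) = begin
    (endsWithMax (v ∷ map (punchIn v) ρ) ∧ (C ∧ chain (map (punchIn v) ρ))) ∧ S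
      ≡⟨ cong₂ (λ e c → (e ∧ (C ∧ c)) ∧ S) (endsWithMax-punchIn v ρ) (chain-punchIn v ρ) ⟩
    ((E ∧ N) ∧ (C ∧ H)) ∧ S
      ≡⟨ solve 5 (λ E N C H S → ((E ⊕ N) ⊕ (C ⊕ H)) ⊕ S ⊜ (E ⊕ H) ⊕ ((N ⊕ C) ⊕ S)) refl E N C H S ⟩
    (E ∧ H) ∧ ((N ∧ C) ∧ S) ∎
    where
    open ≡-Reasoning
    E = endsWithMax ρ
    N = toℕ v ≤ᵇ suc k
    C = cyclicᶠ v (punchIn v a) (punchIn v b)
    H = chain ρ
    S = arc (v ∷ map (punchIn v) ρ) ≡ᵇ t

-- Total cyclic orders on Fin (suc n) versus cyclic chains

cubeOf : ∀ {m} → Vec (Fin m) m → Cube m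
cubeOf τ = tabulate λ x → tabulate λ y → tabulate λ z → cyclicᶠ (lookup τ x) (lookup τ y) (lookup τ z)

cubeOf-∋ : ∀ {m} (τ : Vec (Fin m) m) x y z → cubeOf τ ∋⟨ x , y , z ⟩ ≡ cyclicᶠ (lookup τ x) (lookup τ y) (lookup τ z)
cubeOf-∋ τ x y z = begin
  lookup (lookup (lookup (cubeOf τ) x) y) z ≡⟨ cong (λ Zₓ → lookup (lookup Zₓ y) z) (lookup∘tabulate _ x) ⟩
  lookup (lookup (tabulate _) y) z          ≡⟨ cong (λ Zₓᵧ → lookup Zₓᵧ z) (lookup∘tabulate _ y) ⟩
  lookup (tabulate _) z                     ≡⟨ lookup∘tabulate _ z ⟩
  cyclicᶠ (lookup τ x) (lookup τ y) (lookup τ z) ∎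
  where open ≡-Reasoning

_≺[_]_ : ∀ {m} → Fin m → Vec (Fin m) m → Fin m → Set
x ≺[ τ ] y = toℕ (lookup τ x) < toℕ (lookup τ y)

module _ {m} (τ : Vec (Fin m) m) where

  ⟦cubeOf⟧ : ∀ {x y z} → ⟦ cubeOf τ ⟧ x y z ⇔ Cyclic _≺[ τ ]_ x y z
  ⟦cubeOf⟧ {x} {y} {z} = subst (λ b → T b ⇔ Cyclic _≺[ τ ]_ x y z) (sym (cubeOf-∋ τ x y z)) T-cyclicᵇ

  module _ (τ-distinct : T (distinct τ)) where

    ≺-connected : ∀ {x y} → x ≢ y → x ≺[ τ ] y ⊎ y ≺[ τ ] x
    ≺-connected x≢y = ≢⇒<⊎> (x≢y ∘ to (T-distinct {σ = τ}) τ-distinct ∘ toℕ-injective)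

    open StrictLinearOrder {_<_ = _≺[ τ ]_} (<-irrefl refl) <-trans ≺-connected using (cyclic-isTotalCyclicOrder)

    cubeOf-isTotalCyclicOrder : IsTotalCyclicOrder ⟦ cubeOf τ ⟧
    cubeOf-isTotalCyclicOrder = isTotalCyclicOrder-⇔ ⟦cubeOf⟧ cyclic-isTotalCyclicOrder

T-consecutiveIn : ∀ {m} {Z : Cube m} → T (consecutiveIn Z) ⇔
  (∀ x y z → toℕ y ≡ suc (toℕ x) → toℕ z ≡ suc (suc (toℕ x)) → ⟦ Z ⟧ x y z)
T-consecutiveIn {Z = Z} = mk⇔
  (λ h x y z y≡1+x z≡2+x → to (T-⇒ᵇ {⌊ toℕ y ≟ℕ suc (toℕ x) ⌋ ∧ ⌊ toℕ z ≟ℕ suc (suc (toℕ x)) ⌋})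
      (to T-∀ᶠ (to T-∀ᶠ (to T-∀ᶠ h x) y) z) (from (T-∧ {⌊ toℕ y ≟ℕ suc (toℕ x) ⌋}) (fromWitness y≡1+x , fromWitness z≡2+x)))
  (λ h → from T-∀ᶠ λ x → from T-∀ᶠ λ y → from T-∀ᶠ λ z →
      from (T-⇒ᵇ {⌊ toℕ y ≟ℕ suc (toℕ x) ⌋ ∧ ⌊ toℕ z ≟ℕ suc (suc (toℕ x)) ⌋}) λ consecutive →
        let y≡1+x , z≡2+x = to (T-∧ {⌊ toℕ y ≟ℕ suc (toℕ x) ⌋}) consecutive
        in h x y z (toWitness y≡1+x) (toWitness z≡2+x))

consecutiveIn-cubeOf : ∀ {m} (τ : Vec (Fin m) m) → consecutiveIn (cubeOf τ) ≡ chain τ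
consecutiveIn-cubeOf τ = T-⇔⇒≡ (mk⇔
  (λ h → Chained⇒chain τ λ x y z y≡1+x z≡2+x →
     subst T (cubeOf-∋ τ x y z) (to (T-consecutiveIn {Z = cubeOf τ}) h x y z y≡1+x z≡2+x))
  (λ h → from (T-consecutiveIn {Z = cubeOf τ}) λ x y z y≡1+x z≡2+x →
     subst T (sym (cubeOf-∋ τ x y z)) (chain⇒Chained τ h x y z y≡1+x z≡2+x)))

cube-η : ∀ {m} (Z : Cube m) → tabulate (λ x → tabulate (λ y → tabulate (λ z → Z ∋⟨ x , y , z ⟩))) ≡ Z
cube-η Z = trans (tabulate-cong λ x → trans (tabulate-cong λ y → tabulate∘lookup _) (tabulate∘lookup _)) (tabulate∘lookup Z)

module Linearization {n} (Z : Cube (suc n)) where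

  top : Fin (suc n)
  top = fromℕ n

  cutᵇ : Fin (suc n) → Fin (suc n) → Bool
  cutᵇ x y = Z ∋⟨ top , x , y ⟩ ∨ (neq x top ∧ ⌊ y ≟ top ⌋)

  T-cutᵇ : ∀ {x y} → T (cutᵇ x y) ⇔ cut ⟦ Z ⟧ top x y
  T-cutᵇ {x} {y} = mk⇔
    (λ h → Sum.map₂ (λ h′ → let x≢top , y≡top = to (T-∧ {neq x top}) h′ in to T-neq x≢top , toWitness y≡top)
                          (to (T-∨ {Z ∋⟨ top , x , y ⟩}) h))
    (λ c → from (T-∨ {Z ∋⟨ top , x , y ⟩})
             (Sum.map₂ (λ (x≢top , y≡top) → from (T-∧ {neq x top}) (from T-neq x≢top , fromWitness y≡top)) c))

  rank : Fin (suc n) → ℕ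
  rank y = count (λ x → cutᵇ x y) (allFin (suc n))

  -- rank y ≤ n when Z is a total cyclic order; reducing mod (n + 1) merely makes linearize total
  linearize : Vec (Fin (suc n)) (suc n)
  linearize = tabulate λ y → rank y mod suc n

  module _ (isZ : IsTotalCyclicOrder ⟦ Z ⟧) where
    open IsTotalCyclicOrder isZ using () renaming (distinct to Z-distinct)
    open Cut _≟_ isZ top

    rank-mono : ∀ {x y} → x ⊏ y → rank x < rank y
    rank-mono {x} {y} x⊏y = count-mono-< (λ w w⊏x → from T-cutᵇ (⊏-trans (to T-cutᵇ w⊏x) x⊏y))
                                          (∈-allFin x) (from T-cutᵇ x⊏y) (⊏-irrefl ∘ to T-cutᵇ)

    rank-top : rank top ≡ n
    rank-top = trans (count-cong (λ x → T-⇔⇒≡ (⇔-trans T-cutᵇ (⇔-trans ⊏top⇔≢top (⇔-sym T-neq)))) (allFin (suc n)))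
                     (count-≢ top)
      where
      ⊏top⇔≢top : ∀ {x} → x ⊏ top ⇔ x ≢ top
      ⊏top⇔≢top = mk⇔ (λ { (inj₁ Z⟨top,x,top⟩) → λ _ → proj₂ (proj₂ (Z-distinct Z⟨top,x,top⟩)) refl
                          ; (inj₂ (x≢top , _)) → x≢top })
                       ⊏-max

    rank-<-⇔ : ∀ {x y} → rank x < rank y ⇔ x ⊏ y
    rank-<-⇔ {x} {y} = mk⇔ ⇒ rank-mono
      where
      ⇒ : rank x < rank y → x ⊏ y
      ⇒ rx<ry with x ≟ y
      ... | yes refl = contradiction rx<ry (<-irrefl refl)
      ... | no x≢y with ⊏-connected x≢y
      ...   | inj₁ x⊏y = x⊏y
      ...   | inj₂ y⊏x = contradiction rx<ry (<-asym (rank-mono y⊏x))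

    rank≤n : ∀ x → rank x ≤ n
    rank≤n x = case x ≟ top of λ
      { (yes x≡top) → ≤-reflexive (trans (cong rank x≡top) rank-top)
      ; (no x≢top)  → <⇒≤ (subst (rank x <_) rank-top (rank-mono (⊏-max x≢top))) }

    toℕ-linearize : ∀ x → toℕ (lookup linearize x) ≡ rank x
    toℕ-linearize x = begin
      toℕ (lookup linearize x)  ≡⟨ cong toℕ (lookup∘tabulate (λ y → rank y mod suc n) x) ⟩
      toℕ (rank x mod suc n)    ≡⟨ toℕ-fromℕ< (m%n<n (rank x) (suc n)) ⟩
      rank x % suc n            ≡⟨ m<n⇒m%n≡m (s≤s (rank≤n x)) ⟩
      rank x                    ∎
      where open ≡-Reasoning

    rank-injective : ∀ {x y} → rank x ≡ rank y → x ≡ y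
    rank-injective {x} {y} rx≡ry with x ≟ y
    ... | yes x≡y = x≡y
    ... | no x≢y with ⊏-connected x≢y
    ...   | inj₁ x⊏y = contradiction rx≡ry (ℕ.<⇒≢ (rank-mono x⊏y))
    ...   | inj₂ y⊏x = contradiction (sym rx≡ry) (ℕ.<⇒≢ (rank-mono y⊏x))

    linearize-distinct : T (distinct linearize)
    linearize-distinct = from T-distinct λ {x} {y} lx≡ly →
      rank-injective (trans (sym (toℕ-linearize x)) (trans (cong toℕ lx≡ly) (toℕ-linearize y)))

    linearize-endsWithMax : T (endsWithMax linearize)
    linearize-endsWithMax = from (T-≡ᵇ _ _) (trans (toℕ-linearize top) rank-top)

    cubeOf-linearize : cubeOf linearize ≡ Z
    cubeOf-linearize = trans (tabulate-cong λ x → tabulate-cong λ y → tabulate-cong λ z → entry x y z) (cube-η Z)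
      where
      ≺⇔⊏ : ∀ {x y} → x ≺[ linearize ] y ⇔ x ⊏ y
      ≺⇔⊏ {x} {y} = ⇔-trans (subst₂ (λ a b → (x ≺[ linearize ] y) ⇔ (a < b)) (toℕ-linearize x) (toℕ-linearize y) ⇔-refl)
                            rank-<-⇔
      entry : ∀ x y z → cyclicᶠ (lookup linearize x) (lookup linearize y) (lookup linearize z) ≡ Z ∋⟨ x , y , z ⟩
      entry x y z = T-⇔⇒≡ (⇔-trans
        (T-cyclicᵇ {toℕ (lookup linearize x)} {toℕ (lookup linearize y)} {toℕ (lookup linearize z)}) (mk⇔
        (λ c → cut-cyclic⁻ (cyclic-mono {R = _≺[ linearize ]_} (λ {a} {b} → to (≺⇔⊏ {a} {b})) c))
        (λ Zxyz → cyclic-mono {S = _≺[ linearize ]_} (λ {a} {b} → from (≺⇔⊏ {a} {b})) (cut-cyclic⁺ Zxyz))))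

    chain-linearize : chain linearize ≡ consecutiveIn Z
    chain-linearize = trans (sym (consecutiveIn-cubeOf linearize)) (cong consecutiveIn cubeOf-linearize)

module _ {n} (τ : Vec (Fin (suc n)) (suc n)) (τ-distinct : T (distinct τ)) (τ-max : T (endsWithMax τ)) where
  open Linearization (cubeOf τ)

  private
    below-top : ∀ {y} → y ≢ top → y ≺[ τ ] top
    below-top {y} y≢top = ≤∧≢⇒< (subst (toℕ (lookup τ y) ≤_) (sym (to (T-≡ᵇ _ _) τ-max)) (toℕ≤pred[n] (lookup τ y)))
                                (y≢top ∘ to (T-distinct {σ = τ}) τ-distinct ∘ toℕ-injective)

  rank-cubeOf : ∀ x → rank x ≡ toℕ (lookup τ x)
  rank-cubeOf x = trans (count-cong (λ y → T-⇔⇒≡ (cut⇔below y)) (allFin (suc n))) (count-below-injective τ τ-distinct x)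
    where
    cut⇔below : ∀ y → T (cutᵇ y x) ⇔ T (toℕ (lookup τ y) <ᵇ toℕ (lookup τ x))
    cut⇔below y = ⇔-trans (T-cutᵇ {y} {x})
                 (⇔-trans (cut-⇔ (λ {a} {b} {c} → ⟦cubeOf⟧ τ {a} {b} {c}) {top} {y} {x})
                 (⇔-trans (cut-at-maximum _≟_ (<-irrefl refl) <-trans below-top {y} {x})
                          (⇔-sym (T-<ᵇ _ _))))

  linearize-cubeOf : linearize ≡ τ
  linearize-cubeOf = trans (sym (tabulate∘lookup linearize)) (trans (tabulate-cong entry) (tabulate∘lookup τ))
    where
    entry : ∀ x → lookup linearize x ≡ lookup τ x
    entry x = toℕ-injective (trans (toℕ-linearize (cubeOf-isTotalCyclicOrder τ τ-distinct) x) (rank-cubeOf x))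

alternating≡cyclic : ∀ k up t → t < suc k → alternating-perms up (suc k) t ≡ cyclic-perms (suc k) t
alternating≡cyclic zero    true  zero _ = refl
alternating≡cyclic zero    false zero _ = refl
alternating≡cyclic zero    _     (suc t) (s≤s ())
alternating≡cyclic (suc k) up    t    t<2+k = begin
  alternating-perms up (2 + k) t
    ≡⟨ alternating-perms-insertion up k t t<2+k ⟩
  ∑[ t′ < suc k ] (𝟙 (suc k ≤ᵇ t + toℕ t′) * alternating-perms (not up) (suc k) (toℕ t′))
    ≡⟨ sum-cong-≗ {suc k} (λ t′ → cong (𝟙 (suc k ≤ᵇ t + toℕ t′) *_) (alternating≡cyclic k (not up) (toℕ t′) (toℕ<n t′))) ⟩
  ∑[ t′ < suc k ] (𝟙 (suc k ≤ᵇ t + toℕ t′) * cyclic-perms (suc k) (toℕ t′))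
    ≡⟨ cyclic-perms-insertion k t t<2+k ⟨
  cyclic-perms (2 + k) t ∎
  where open ≡-Reasoning

EulerNumber≡∑ : ∀ k → EulerNumber (suc k) ≡ ∑[ t < suc k ] alternating-perms true (suc k) (toℕ t)
EulerNumber≡∑ k =
  trans (count-cong (λ σ → cong₂ _∧_ (isPermutation≡distinct σ) (isUpDown≡alternating σ)) (vecs (allFin (suc k)) (suc k)))
        (count-perms-by-value (suc k) (suc k) (alternating true) (room true) (λ σ _ _ → room-bound true σ))

cyclic-chains≡∑ : ∀ k → count (λ σ → distinct σ ∧ isCyclicChain σ) (vecs (allFin (2 + k)) (2 + k))
                        ≡ ∑[ t < suc k ] cyclic-perms (suc k) (toℕ t)
cyclic-chains≡∑ k = count-perms-by-value (2 + k) (suc k) _ arc (λ σ σ-distinct _ → arc-bound σ σ-distinct)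

cubes≡cyclic-chains : ∀ n → count (λ Z → isTotalCyclicOrder Z ∧ consecutiveIn Z) (allCubes (suc n))
                          ≡ count (λ σ → distinct σ ∧ isCyclicChain σ) (vecs (allFin (suc n)) (suc n))
cubes≡cyclic-chains n = count-bijection (allCubes-unique (suc n)) (perms-unique (suc n)) allCubes-complete perms-complete
  _ _ linearize cubeOf linearize-good cubeOf-good cubeOf-linearize′ linearize-cubeOf′
  where
  open Linearization using (linearize)
  Good : Vec (Fin (suc n)) (suc n) → Bool
  Good σ = distinct σ ∧ isCyclicChain σ
  good-parts : ∀ (σ : Vec (Fin (suc n)) (suc n)) → T (Good σ) → T (distinct σ) × T (endsWithMax σ) × T (chain σ)
  good-parts σ h = let σ-distinct , rest = to (T-∧ {distinct σ}) h in σ-distinct , to (T-∧ {endsWithMax σ}) rest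
  isTCO : ∀ (Z : Cube (suc n)) → T (isTotalCyclicOrder Z ∧ consecutiveIn Z) → IsTotalCyclicOrder ⟦ Z ⟧
  isTCO Z h = to (T-isTotalCyclicOrder {Z = Z}) (proj₁ (to (T-∧ {isTotalCyclicOrder Z}) h))

  linearize-good : ∀ Z → T (isTotalCyclicOrder Z ∧ consecutiveIn Z) → T (Good (linearize Z))
  linearize-good Z h = from (T-∧ {distinct (linearize Z)})
    ( Linearization.linearize-distinct Z (isTCO Z h)
    , from (T-∧ {endsWithMax (linearize Z)})
        ( Linearization.linearize-endsWithMax Z (isTCO Z h)
        , subst T (sym (Linearization.chain-linearize Z (isTCO Z h))) (proj₂ (to (T-∧ {isTotalCyclicOrder Z}) h))))
  cubeOf-good : ∀ σ → T (Good σ) → T (isTotalCyclicOrder (cubeOf σ) ∧ consecutiveIn (cubeOf σ))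
  cubeOf-good σ h = let σ-distinct , _ , σ-chain = good-parts σ h in from (T-∧ {isTotalCyclicOrder (cubeOf σ)})
    (from (T-isTotalCyclicOrder {Z = cubeOf σ}) (cubeOf-isTotalCyclicOrder σ σ-distinct) , subst T (sym (consecutiveIn-cubeOf σ)) σ-chain)
  cubeOf-linearize′ : ∀ Z → T (isTotalCyclicOrder Z ∧ consecutiveIn Z) → cubeOf (linearize Z) ≡ Z
  cubeOf-linearize′ Z h = Linearization.cubeOf-linearize Z (isTCO Z h)
  linearize-cubeOf′ : ∀ σ → T (Good σ) → linearize (cubeOf σ) ≡ σ
  linearize-cubeOf′ σ h = let σ-distinct , σ-max , _ = good-parts σ h in linearize-cubeOf σ σ-distinct σ-max

corollary1 : (n : ℕ) → n ≥ 1 →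
    EulerNumber n ≡ count (λ Z → isTotalCyclicOrder Z ∧ consecutiveIn Z) (allCubes (suc n))
corollary1 (suc k) _ = begin
  EulerNumber (suc k)                                 ≡⟨ EulerNumber≡∑ k ⟩
  ∑[ t < suc k ] alternating-perms true (suc k) (toℕ t) ≡⟨ sum-cong-≗ {suc k} (λ t → alternating≡cyclic k true (toℕ t) (toℕ<n t)) ⟩
  ∑[ t < suc k ] cyclic-perms (suc k) (toℕ t)          ≡⟨ cyclic-chains≡∑ k ⟨
  count (λ σ → distinct σ ∧ isCyclicChain σ) (vecs (allFin (2 + k)) (2 + k)) ≡⟨ cubes≡cyclic-chains (suc k) ⟨
  count (λ Z → isTotalCyclicOrder Z ∧ consecutiveIn Z) (allCubes (2 + k)) ∎
  where open ≡-Reasoning
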